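{- Let $\beta>1$ be a quadratic Pisot unit whose algebraic conjugate is positive. Then every rational number $x\in I_\beta=\left[-\frac{\beta}{\beta+1},\frac{1}{\beta+1}\right)$ has a purely periodic $(-\beta)$-expansion, i.e. the digit string $d_{ -\beta}(x)$ is purely periodic.
   Context: For $\beta>1$ let $I_\beta=\left[-\frac{\beta}{\beta+1},\frac{1}{\beta+1}\right)$ and define $T_{ -\beta}:I_\beta\to I_\beta$ by $T_{ -\beta}(x)=-\beta x-\left\lfloor -\beta x+\frac{\beta}{\beta+1}\right\rfloor$. For $x\in I_\beta$ put $x_i=\left\lfloor -\beta T_{ -\beta}^{i-1}(x)+\frac{\beta}{\beta+1}\right\rfloor\in\{0,1,\dots,\lfloor\beta\rfloor\}$; then $x=\sum_{i\ge1}x_i(-\beta)^{ -i}$, and $d_{ -\beta}(x):=x_1x_2x_3\cdots$ is the $(-\beta)$-expansion of $x$. It is purely periodic if $d_{ -\beta}(x)=(a_1\cdots a_N)^\omega$ for some finite word $a_1\cdots a_N$. -}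

module Defs where

open import Data.Nat as ℕ using (ℕ; suc)
open import Data.Integer as ℤ using (ℤ)
open import Data.Rational as ℚ using (ℚ; 0ℚ; 1ℚ; _/_)
open import Data.Product using (Σ; ∃; _×_; _,_)
open import Data.Sum using (_⊎_)
open import Relation.Binary.PropositionalEquality using (_≡_; _≢_)
open import Relation.Nullary using (¬_)

ℤ→ℚ : ℤ → ℚ
ℤ→ℚ z = z / 1

NonSquare : ℕ → Set
NonSquare D = ∀ (r : ℚ) → ¬ (r ℚ.* r ≡ ℤ→ℚ (ℤ.+ D))

-- The real quadratic field ℚ(√D) ⊂ ℝ, with √D the POSITIVE square root.
-- An element  p +√ q  stands for the real number p + q·√D.
record K : Set where
  constructor _+√_
  field
    re : ℚ
    im : ℚ
open K public

module QD (D : ℕ) where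
  Dℚ : ℚ
  Dℚ = ℤ→ℚ (ℤ.+ D)

  ι : ℚ → K
  ι r = r +√ 0ℚ

  infixl 6 _⊕_ _⊖_
  infixl 7 _⊗_

  _⊕_ : K → K → K
  (a +√ b) ⊕ (c +√ d) = (a ℚ.+ c) +√ (b ℚ.+ d)

  ⊝_ : K → K
  ⊝ (a +√ b) = (ℚ.- a) +√ (ℚ.- b)

  _⊖_ : K → K → K
  x ⊖ y = x ⊕ (⊝ y)

  _⊗_ : K → K → K
  (a +√ b) ⊗ (c +√ d) = (a ℚ.* c ℚ.+ Dℚ ℚ.* b ℚ.* d) +√ (a ℚ.* d ℚ.+ b ℚ.* c)

  conj : K → K
  conj (a +√ b) = a +√ (ℚ.- b)

  -- Strict positivity of the real number p + q·√D (√D > 0).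
  Pos : K → Set
  Pos (p +√ q) =
      (0ℚ ℚ.≤ p × 0ℚ ℚ.≤ q × (0ℚ ℚ.< p ⊎ 0ℚ ℚ.< q))
    ⊎ (0ℚ ℚ.< p × q ℚ.< 0ℚ × Dℚ ℚ.* q ℚ.* q ℚ.< p ℚ.* p)
    ⊎ (p ℚ.< 0ℚ × 0ℚ ℚ.< q × p ℚ.* p ℚ.< Dℚ ℚ.* q ℚ.* q)

  _<ᴷ_ : K → K → Set
  x <ᴷ y = Pos (y ⊖ x)

  _≤ᴷ_ : K → K → Set
  x ≤ᴷ y = x ≡ y ⊎ x <ᴷ y

  IsInteger : ℚ → Set
  IsInteger r = ∃ λ (z : ℤ) → r ≡ ℤ→ℚ z

  -- β ∈ ℚ(√D) is a quadratic Pisot unit (β > 1, β irrational, β an algebraic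
  -- integer whose minimal polynomial X² − (β+β')X + ββ' has integer
  -- coefficients, norm ββ' = ±1, and its unique other conjugate β' satisfies
  -- |β'| < 1) whose algebraic conjugate β' is positive.
  record QuadPisotUnitPosConj (β : K) : Set where
    field
      gt1        : ι 1ℚ <ᴷ β
      irrational : im β ≢ 0ℚ
      traceInt   : IsInteger (re (β ⊕ conj β))
      normUnit   : re (β ⊗ conj β) ≡ 1ℚ ⊎ re (β ⊗ conj β) ≡ ℚ.- 1ℚ
      conjSmall  : ι (ℚ.- 1ℚ) <ᴷ conj β × conj β <ᴷ ι 1ℚ
      conjPos    : ι 0ℚ <ᴷ conj β

  IsFloor : K → ℤ → Set
  IsFloor y k = ι (ℤ→ℚ k) ≤ᴷ y × y <ᴷ ι (ℤ→ℚ (k ℤ.+ ℤ.+ 1))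

  -- Given c = β/(β+1) (i.e. c(β+1) = β), t is the T_{-β}-orbit of x
  -- (t i = T_{-β}^i(x)) and d i = x_{i+1} is the (i+1)-st digit of d_{-β}(x):
  --   x_{i+1} = ⌊ −β T^i(x) + β/(β+1) ⌋,   T^{i+1}(x) = −β T^i(x) − x_{i+1}.
  record IsNegBetaExpansion (β c x : K) (t : ℕ → K) (d : ℕ → ℤ) : Set where
    field
      start : t 0 ≡ x
      digit : ∀ i → IsFloor ((⊝ β) ⊗ t i ⊕ c) (d i)
      step  : ∀ i → t (suc i) ≡ (⊝ β) ⊗ t i ⊖ ι (ℤ→ℚ (d i))

PurelyPeriodic : (ℕ → ℤ) → Set
PurelyPeriodic d = ∃ λ (N : ℕ) → (0 ℕ.< N) × (∀ i → d (N ℕ.+ i) ≡ d i)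

-- Write β′ for the conjugate of β; then ββ′ = 1, 0 < β′ < 1 and a = β + β′ ≥ 3 is an
-- integer. The orbit t n = T^n(x) stays in [−c, 1 − c) with digits 0 ≤ d n < a, and
-- since each step multiplies by −β and subtracts an integer, Q·t n ∈ ℤ[β] for the
-- denominator Q of x. The Galois conjugates s n of the orbit obey s ↦ −β′s − d and
-- stay in a bounded interval (Lo, Hi). An element of ℤ[β] bounded together with its
-- conjugate has bounded integer coordinates, so the orbit repeats. It repeats from
-- the start because T is injective on the orbit: equal images force digits whose
-- difference is β′ times a difference of two points of (Lo, Hi), hence smaller than
-- β′β = 1 in absolute value. The digits are read off the orbit, so they are purely
-- periodic too.

module Submission where

open import Data.Nat as ℕ using (ℕ; zero; suc)
import Data.Nat.Properties as ℕP
import Data.Nat.Coprimality as Coprime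
open import Data.Integer as ℤ using (ℤ; +_; -[1+_]; +[1+_])
import Data.Integer.Properties as ℤP
open import Data.Rational as ℚ using (ℚ; 0ℚ; 1ℚ; _+_; _*_; -_; _-_; _<_; _≤_; _⊔_; _⊓_; mkℚ)
import Data.Rational.Properties as QP
import Data.Rational.Unnormalised as ℚᵘ
import Data.Rational.Unnormalised.Properties as ℚᵘP
open import Data.Rational.Solver using (module +-*-Solver)
open import Data.Fin as Fin using (Fin; toℕ; fromℕ<; combine)
import Data.Fin.Properties as FinP
open import Data.Product using (_×_; _,_; ∃; ∃₂; proj₁; proj₂)
open import Data.Sum using (_⊎_; inj₁; inj₂; [_,_]′)
open import Data.Empty using (⊥; ⊥-elim)
open import Data.Maybe using (just; nothing)
open import Relation.Binary.PropositionalEquality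
open import Relation.Binary using (Tri; tri<; tri≈; tri>)
open import Relation.Binary.Definitions using (WeaklyDecidable)
open import Relation.Nullary using (¬_; Dec; yes; no)
open import Algebra.Structures using (IsCommutativeMonoid)
open import Algebra.Structures.Biased using (IsCommutativeSemiringˡ)
open import Algebra.Solver.Ring.AlmostCommutativeRing
  using (AlmostCommutativeRing; _-Raw-AlmostCommutative⟶_; Induced-equivalence)
import Algebra.Solver.Ring
open import Algebra.Properties.AbelianGroup ℤP.+-0-abelianGroup using () renaming (∙-cancelʳ to +-cancelʳ)
open import Defs

module ℚ-Order where
  open +-*-Solver

  private variable a b : ℚ

  <⇒0<- : a < b → 0ℚ < b - a
  <⇒0<- {a} {b} a<b = subst (_< b - a) (QP.+-inverseʳ a) (QP.+-monoˡ-< (- a) a<b)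

  ≤⇒0≤- : a ≤ b → 0ℚ ≤ b - a
  ≤⇒0≤- {a} {b} a≤b = subst (_≤ b - a) (QP.+-inverseʳ a) (QP.+-monoˡ-≤ (- a) a≤b)

  0<-⇒< : 0ℚ < b - a → a < b
  0<-⇒< {b} {a} h =
    subst₂ _<_ (QP.+-identityˡ a) (solve 2 (λ a b → (b :- a) :+ a := b) refl a b) (QP.+-monoˡ-< a h)

  0≤-⇒≤ : 0ℚ ≤ b - a → a ≤ b
  0≤-⇒≤ {b} {a} h =
    subst₂ _≤_ (QP.+-identityˡ a) (solve 2 (λ a b → (b :- a) :+ a := b) refl a b) (QP.+-monoˡ-≤ a h)

  pos+pos : 0ℚ < a → 0ℚ < b → 0ℚ < a + b
  pos+pos = QP.+-mono-<

  pos+nonNeg : 0ℚ < a → 0ℚ ≤ b → 0ℚ < a + b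
  pos+nonNeg = QP.+-mono-<-≤

  nonNeg+pos : 0ℚ ≤ a → 0ℚ < b → 0ℚ < a + b
  nonNeg+pos = QP.+-mono-≤-<

  nonNeg+nonNeg : 0ℚ ≤ a → 0ℚ ≤ b → 0ℚ ≤ a + b
  nonNeg+nonNeg = QP.+-mono-≤

  pos*pos : 0ℚ < a → 0ℚ < b → 0ℚ < a * b
  pos*pos {a} {b} 0<a 0<b =
    QP.positive⁻¹ (a * b) {{QP.pos*pos⇒pos a {{ℚ.positive 0<a}} b {{ℚ.positive 0<b}}}}

  nonNeg*nonNeg : 0ℚ ≤ a → 0ℚ ≤ b → 0ℚ ≤ a * b
  nonNeg*nonNeg {a} {b} 0≤a 0≤b =
    QP.nonNegative⁻¹ (a * b) {{QP.nonNeg*nonNeg⇒nonNeg a {{ℚ.nonNegative 0≤a}} b {{ℚ.nonNegative 0≤b}}}}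

  0≮0 : ¬ (0ℚ < 0ℚ)
  0≮0 = QP.<-irrefl refl

  pos∧neg⇒⊥ : 0ℚ < a → 0ℚ < - a → ⊥
  pos∧neg⇒⊥ {a} 0<a 0<-a =
    0≮0 (subst (0ℚ <_) (solve 1 (λ a → a :+ (:- a) := con 0ℚ) refl a) (pos+pos 0<a 0<-a))

  nonNeg∧≢0⇒pos : 0ℚ ≤ a → a ≢ 0ℚ → 0ℚ < a
  nonNeg∧≢0⇒pos {a} 0≤a a≢0 with QP.<-cmp 0ℚ a
  ... | tri< 0<a _ _ = 0<a
  ... | tri≈ _ 0≡a _ = ⊥-elim (a≢0 (sym 0≡a))
  ... | tri> _ _ a<0 = ⊥-elim (QP.<-irrefl refl (QP.<-≤-trans a<0 0≤a))

  square-pos : a ≢ 0ℚ → 0ℚ < a * a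
  square-pos {a} a≢0 with QP.<-cmp 0ℚ a
  ... | tri< 0<a _ _ = pos*pos 0<a 0<a
  ... | tri≈ _ 0≡a _ = ⊥-elim (a≢0 (sym 0≡a))
  ... | tri> _ _ a<0 =
    subst (0ℚ <_) (solve 1 (λ a → (:- a) :* (:- a) := a :* a) refl a)
      (pos*pos (QP.neg-antimono-< a<0) (QP.neg-antimono-< a<0))

  square≡0⇒≡0 : a * a ≡ 0ℚ → a ≡ 0ℚ
  square≡0⇒≡0 {a} aa≡0 with a QP.≟ 0ℚ
  ... | yes a≡0 = a≡0
  ... | no a≢0 = ⊥-elim (0≮0 (subst (0ℚ <_) aa≡0 (square-pos a≢0)))

  square-nonNeg : ∀ a → 0ℚ ≤ a * a
  square-nonNeg a with a QP.≟ 0ℚ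
  ... | yes refl = QP.≤-refl
  ... | no a≢0 = QP.<⇒≤ (square-pos a≢0)

  pos*∧pos+⇒pos : 0ℚ < a * b → 0ℚ < a + b → 0ℚ < a
  pos*∧pos+⇒pos {a} {b} 0<ab 0<a+b with QP.<-cmp 0ℚ a
  ... | tri< 0<a _ _ = 0<a
  ... | tri≈ _ refl _ = ⊥-elim (0≮0 (subst (0ℚ <_) (QP.*-zeroˡ b) 0<ab))
  ... | tri> _ _ a<0 with QP.<-cmp 0ℚ b
  ...   | tri< 0<b _ _ = ⊥-elim (pos∧neg⇒⊥ 0<ab
          (subst (0ℚ <_) (solve 2 (λ a b → (:- a) :* b := :- (a :* b)) refl a b)
            (pos*pos (QP.neg-antimono-< a<0) 0<b)))
  ...   | tri≈ _ refl _ = ⊥-elim (0≮0 (subst (0ℚ <_) (QP.*-zeroʳ a) 0<ab))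
  ...   | tri> _ _ b<0 = ⊥-elim (pos∧neg⇒⊥ 0<a+b
          (subst (0ℚ <_) (solve 2 (λ a b → (:- a) :+ (:- b) := :- (a :+ b)) refl a b)
            (pos+pos (QP.neg-antimono-< a<0) (QP.neg-antimono-< b<0))))

  record PositiveInverse (a : ℚ) : Set where
    field
      inverse     : ℚ
      inverse-pos : 0ℚ < inverse
      *-inverse   : a * inverse ≡ 1ℚ

  positiveInverse : 0ℚ < a → PositiveInverse a
  positiveInverse {a} 0<a = record
    { inverse     = ℚ.1/ a
    ; inverse-pos = QP.positive⁻¹ _ {{QP.1/pos⇒pos a {{ℚ.positive 0<a}}}}
    ; *-inverse   = QP.*-inverseʳ a }
    where instance _ = QP.pos⇒nonZero a {{ℚ.positive 0<a}}

module ℤ→ℚ-Properties where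

  private
    fromℤ : ℤ → ℚ
    fromℤ z = mkℚ z 0 (Coprime.sym (Coprime.1-coprimeTo _))

    ℤ→ℚ≡fromℤ : ∀ z → ℤ→ℚ z ≡ fromℤ z
    ℤ→ℚ≡fromℤ z = QP.↥p/↧p≡p (fromℤ z)

  ℤ→ℚ-+ : ∀ z w → ℤ→ℚ (z ℤ.+ w) ≡ ℤ→ℚ z + ℤ→ℚ w
  ℤ→ℚ-+ z w rewrite ℤ→ℚ≡fromℤ z | ℤ→ℚ≡fromℤ w =
    sym (cong (ℚ._/ 1) (cong₂ ℤ._+_ (ℤP.*-identityʳ z) (ℤP.*-identityʳ w)))

  ℤ→ℚ-* : ∀ z w → ℤ→ℚ (z ℤ.* w) ≡ ℤ→ℚ z * ℤ→ℚ w
  ℤ→ℚ-* z w rewrite ℤ→ℚ≡fromℤ z | ℤ→ℚ≡fromℤ w = refl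

  ℤ→ℚ-neg : ∀ z → ℤ→ℚ (ℤ.- z) ≡ - ℤ→ℚ z
  ℤ→ℚ-neg z rewrite ℤ→ℚ≡fromℤ z | ℤ→ℚ≡fromℤ (ℤ.- z) = fromℤ-neg z
    where
    fromℤ-neg : ∀ z → fromℤ (ℤ.- z) ≡ - fromℤ z
    fromℤ-neg (+ zero) = refl
    fromℤ-neg +[1+ n ] = refl
    fromℤ-neg -[1+ n ] = refl

  ℤ→ℚ-cancel-< : ∀ {z w} → ℤ→ℚ z < ℤ→ℚ w → z ℤ.< w
  ℤ→ℚ-cancel-< {z} {w} z<w rewrite ℤ→ℚ≡fromℤ z | ℤ→ℚ≡fromℤ w with z<w
  ... | ℚ.*<* p = subst₂ ℤ._<_ (ℤP.*-identityʳ z) (ℤP.*-identityʳ w) p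

  ℤ→ℚ-mono-< : ∀ {z w} → z ℤ.< w → ℤ→ℚ z < ℤ→ℚ w
  ℤ→ℚ-mono-< {z} {w} z<w rewrite ℤ→ℚ≡fromℤ z | ℤ→ℚ≡fromℤ w =
    ℚ.*<* (subst₂ ℤ._<_ (sym (ℤP.*-identityʳ z)) (sym (ℤP.*-identityʳ w)) z<w)

  denominator*x≡numerator : ∀ x → ℤ→ℚ (ℚ.denominator x) * x ≡ ℤ→ℚ (ℚ.numerator x)
  denominator*x≡numerator x@(mkℚ n d _) = trans (cong (_* x) (ℤ→ℚ≡fromℤ (+ suc d)))
    (QP.toℚᵘ-injective (ℚᵘP.≃-trans (QP.toℚᵘ-fromℚᵘ (ℚᵘ.mkℚᵘ (+ suc d ℤ.* n) (d ℕ.+ 0)))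
      (ℚᵘP.≃-trans (ℚᵘ.*≡* cross) (ℚᵘP.≃-sym (QP.toℚᵘ-fromℚᵘ (ℚᵘ.mkℚᵘ n 0))))))
    where
    cross : (+ suc d ℤ.* n) ℤ.* + 1 ≡ n ℤ.* + suc (d ℕ.+ 0)
    cross = trans (ℤP.*-identityʳ _) (trans (ℤP.*-comm (+ suc d) n)
              (cong (λ k → n ℤ.* + suc k) (sym (ℕP.+-identityʳ d))))


module QuadraticField (D : ℕ) where
  open QD D public
  open +-*-Solver

  0ᴷ 1ᴷ : K
  0ᴷ = ι 0ℚ
  1ᴷ = ι 1ℚ

  ιℤ : ℤ → K
  ιℤ z = ι (ℤ→ℚ z)

  ⊕-comm : ∀ x y → x ⊕ y ≡ y ⊕ x
  ⊕-comm x y = cong₂ _+√_ (QP.+-comm (re x) (re y)) (QP.+-comm (im x) (im y))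

  ⊕-assoc : ∀ x y z → (x ⊕ y) ⊕ z ≡ x ⊕ (y ⊕ z)
  ⊕-assoc x y z = cong₂ _+√_ (QP.+-assoc (re x) (re y) (re z)) (QP.+-assoc (im x) (im y) (im z))

  ⊕-identityˡ : ∀ x → 0ᴷ ⊕ x ≡ x
  ⊕-identityˡ x = cong₂ _+√_ (QP.+-identityˡ (re x)) (QP.+-identityˡ (im x))

  ⊕-identityʳ : ∀ x → x ⊕ 0ᴷ ≡ x
  ⊕-identityʳ x = cong₂ _+√_ (QP.+-identityʳ (re x)) (QP.+-identityʳ (im x))

  ⊗-comm : ∀ x y → x ⊗ y ≡ y ⊗ x
  ⊗-comm (a +√ b) (c +√ d) = cong₂ _+√_
    (solve 5 (λ a b c d D → a :* c :+ D :* b :* d := c :* a :+ D :* d :* b) refl a b c d Dℚ)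
    (solve 4 (λ a b c d → a :* d :+ b :* c := c :* b :+ d :* a) refl a b c d)

  ⊗-assoc : ∀ x y z → (x ⊗ y) ⊗ z ≡ x ⊗ (y ⊗ z)
  ⊗-assoc (a +√ b) (c +√ d) (e +√ f) = cong₂ _+√_
    (solve 7 (λ a b c d e f D → (a :* c :+ D :* b :* d) :* e :+ D :* (a :* d :+ b :* c) :* f
                              := a :* (c :* e :+ D :* d :* f) :+ D :* b :* (c :* f :+ d :* e))
       refl a b c d e f Dℚ)
    (solve 7 (λ a b c d e f D → (a :* c :+ D :* b :* d) :* f :+ (a :* d :+ b :* c) :* e
                              := a :* (c :* f :+ d :* e) :+ b :* (c :* e :+ D :* d :* f))
       refl a b c d e f Dℚ)

  ⊗-identityˡ : ∀ x → 1ᴷ ⊗ x ≡ x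
  ⊗-identityˡ (a +√ b) = cong₂ _+√_
    (solve 3 (λ a b D → con 1ℚ :* a :+ D :* con 0ℚ :* b := a) refl a b Dℚ)
    (solve 2 (λ a b → con 1ℚ :* b :+ con 0ℚ :* a := b) refl a b)

  ⊗-identityʳ : ∀ x → x ⊗ 1ᴷ ≡ x
  ⊗-identityʳ x = trans (⊗-comm x 1ᴷ) (⊗-identityˡ x)

  ⊗-distribʳ-⊕ : ∀ x y z → (y ⊕ z) ⊗ x ≡ (y ⊗ x) ⊕ (z ⊗ x)
  ⊗-distribʳ-⊕ (a +√ b) (c +√ d) (e +√ f) = cong₂ _+√_
    (solve 7 (λ a b c d e f D → (c :+ e) :* a :+ D :* (d :+ f) :* b
                              := (c :* a :+ D :* d :* b) :+ (e :* a :+ D :* f :* b)) refl a b c d e f Dℚ)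
    (solve 6 (λ a b c d e f → (c :+ e) :* b :+ (d :+ f) :* a
                            := (c :* b :+ d :* a) :+ (e :* b :+ f :* a)) refl a b c d e f)

  ⊗-zeroˡ : ∀ x → 0ᴷ ⊗ x ≡ 0ᴷ
  ⊗-zeroˡ (a +√ b) = cong₂ _+√_
    (solve 3 (λ a b D → con 0ℚ :* a :+ D :* con 0ℚ :* b := con 0ℚ) refl a b Dℚ)
    (solve 2 (λ a b → con 0ℚ :* b :+ con 0ℚ :* a := con 0ℚ) refl a b)

  ⊝-distribˡ-⊗ : ∀ x y → (⊝ x) ⊗ y ≡ ⊝ (x ⊗ y)
  ⊝-distribˡ-⊗ (a +√ b) (c +√ d) = cong₂ _+√_
    (solve 5 (λ a b c d D → (:- a) :* c :+ D :* (:- b) :* d := :- (a :* c :+ D :* b :* d)) refl a b c d Dℚ)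
    (solve 4 (λ a b c d → (:- a) :* d :+ (:- b) :* c := :- (a :* d :+ b :* c)) refl a b c d)

  ⊝-distrib-⊕ : ∀ x y → (⊝ x) ⊕ (⊝ y) ≡ ⊝ (x ⊕ y)
  ⊝-distrib-⊕ (a +√ b) (c +√ d) = cong₂ _+√_ (sym (QP.neg-distrib-+ a c)) (sym (QP.neg-distrib-+ b d))

  ring : AlmostCommutativeRing _ _
  ring = record
    { Carrier = K ; _≈_ = _≡_ ; _+_ = _⊕_ ; _*_ = _⊗_ ; -_ = ⊝_ ; 0# = 0ᴷ ; 1# = 1ᴷ
    ; isAlmostCommutativeRing = record
      { isCommutativeSemiring = IsCommutativeSemiringˡ.isCommutativeSemiring record
          { +-isCommutativeMonoid = commutativeMonoid _⊕_ 0ᴷ ⊕-assoc ⊕-identityˡ ⊕-identityʳ ⊕-comm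
          ; *-isCommutativeMonoid = commutativeMonoid _⊗_ 1ᴷ ⊗-assoc ⊗-identityˡ ⊗-identityʳ ⊗-comm
          ; distribʳ = ⊗-distribʳ-⊕
          ; zeroˡ = ⊗-zeroˡ }
      ; -‿cong = cong ⊝_
      ; -‿*-distribˡ = ⊝-distribˡ-⊗
      ; -‿+-comm = ⊝-distrib-⊕ } }
    where
    commutativeMonoid : ∀ _∙_ e → (∀ x y z → (x ∙ y) ∙ z ≡ x ∙ (y ∙ z)) → (∀ x → e ∙ x ≡ x) →
                        (∀ x → x ∙ e ≡ x) → (∀ x y → x ∙ y ≡ y ∙ x) → IsCommutativeMonoid _≡_ _∙_ e
    commutativeMonoid _∙_ e assoc idˡ idʳ comm = record
      { isMonoid = record
        { isSemigroup = record
          { isMagma = record { isEquivalence = isEquivalence ; ∙-cong = cong₂ _∙_ }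
          ; assoc = assoc }
        ; identity = idˡ , idʳ }
      ; comm = comm }

  ι-* : ∀ r s → ι (r * s) ≡ ι r ⊗ ι s
  ι-* r s = cong₂ _+√_
    (solve 3 (λ r s D → r :* s := r :* s :+ D :* con 0ℚ :* con 0ℚ) refl r s Dℚ)
    (solve 2 (λ r s → con 0ℚ := r :* con 0ℚ :+ con 0ℚ :* s) refl r s)

  ιℤ-+ : ∀ z w → ιℤ (z ℤ.+ w) ≡ ιℤ z ⊕ ιℤ w
  ιℤ-+ z w = cong ι (ℤ→ℚ-Properties.ℤ→ℚ-+ z w)

  ιℤ-* : ∀ z w → ιℤ (z ℤ.* w) ≡ ιℤ z ⊗ ιℤ w
  ιℤ-* z w = trans (cong ι (ℤ→ℚ-Properties.ℤ→ℚ-* z w)) (ι-* (ℤ→ℚ z) (ℤ→ℚ w))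

  ιℤ-⊝ : ∀ z → ιℤ (ℤ.- z) ≡ ⊝ ιℤ z
  ιℤ-⊝ z = cong ι (ℤ→ℚ-Properties.ℤ→ℚ-neg z)

  ιℤ-morphism : ℤ.+-*-rawRing -Raw-AlmostCommutative⟶ ring
  ιℤ-morphism = record
    { ⟦_⟧ = ιℤ ; +-homo = ιℤ-+ ; *-homo = ιℤ-* ; -‿homo = ιℤ-⊝ ; 0-homo = refl ; 1-homo = refl }

  ιℤ-≟ : WeaklyDecidable (Induced-equivalence ιℤ-morphism)
  ιℤ-≟ z w with z ℤ.≟ w
  ... | yes z≡w = just (cong ιℤ z≡w)
  ... | no _    = nothing

  -- Ring normalisation in K with integer coefficients: a constant con z denotes ιℤ z.
  module K-Solver = Algebra.Solver.Ring ℤ.+-*-rawRing ring ιℤ-morphism ιℤ-≟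

  ιℤ-⊖ : ∀ z w → ιℤ (z ℤ.- w) ≡ ιℤ z ⊖ ιℤ w
  ιℤ-⊖ z w = trans (ιℤ-+ z (ℤ.- w)) (cong (ιℤ z ⊕_) (ιℤ-⊝ w))

  conj-⊕ : ∀ x y → conj (x ⊕ y) ≡ conj x ⊕ conj y
  conj-⊕ x y = cong (re (x ⊕ y) +√_) (QP.neg-distrib-+ (im x) (im y))

  conj-⊗ : ∀ x y → conj (x ⊗ y) ≡ conj x ⊗ conj y
  conj-⊗ (a +√ b) (c +√ d) = cong₂ _+√_
    (solve 5 (λ a b c d D → a :* c :+ D :* b :* d := a :* c :+ D :* (:- b) :* (:- d)) refl a b c d Dℚ)
    (solve 4 (λ a b c d → :- (a :* d :+ b :* c) := a :* (:- d) :+ (:- b) :* c) refl a b c d)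

  N : K → ℚ
  N (p +√ q) = p * p - Dℚ * q * q

  ⊗-conj : ∀ z → z ⊗ conj z ≡ ι (N z)
  ⊗-conj (p +√ q) = cong₂ _+√_
    (solve 3 (λ p q D → p :* p :+ D :* q :* (:- q) := p :* p :- D :* q :* q) refl p q Dℚ)
    (solve 2 (λ p q → p :* (:- q) :+ q :* p := con 0ℚ) refl p q)

  N-⊗ : ∀ x y → N (x ⊗ y) ≡ N x * N y
  N-⊗ (p +√ q) (r +√ s) = solve 5 (λ p q r s D →
    (p :* r :+ D :* q :* s) :* (p :* r :+ D :* q :* s) :- D :* (p :* s :+ q :* r) :* (p :* s :+ q :* r)
    := (p :* p :- D :* q :* q) :* (r :* r :- D :* s :* s)) refl p q r s Dℚ

  N-⊝ : ∀ z → N (⊝ z) ≡ N z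
  N-⊝ (p +√ q) = solve 3 (λ p q D → (:- p) :* (:- p) :- D :* (:- q) :* (:- q) := p :* p :- D :* q :* q) refl p q Dℚ


1<nonSquare : ∀ D → NonSquare D → 1ℚ < ℤ→ℚ (+ D)
1<nonSquare 0 nonSquare = ⊥-elim (nonSquare 0ℚ refl)
1<nonSquare 1 nonSquare = ⊥-elim (nonSquare 1ℚ refl)
1<nonSquare (suc (suc k)) _ = ℤ→ℚ-Properties.ℤ→ℚ-mono-< {+ 1} {+ suc (suc k)} (ℤ.+<+ (ℕ.s≤s (ℕ.s≤s ℕ.z≤n)))

module Positivity (D : ℕ) (nonSquare : NonSquare D) where
  open QuadraticField D
  open ℚ-Order
  open +-*-Solver
  open ≡-Reasoning

  0<1 : 0ℚ < 1ℚ
  0<1 = ℤ→ℚ-Properties.ℤ→ℚ-mono-< {+ 0} {+ 1} (ℤ.+<+ (ℕ.s≤s ℕ.z≤n))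

  1<D : 1ℚ < Dℚ
  1<D = 1<nonSquare D nonSquare

  0<D : 0ℚ < Dℚ
  0<D = QP.<-trans 0<1 1<D

  N≡0⇒≡0ᴷ : ∀ z → N z ≡ 0ℚ → z ≡ 0ᴷ
  N≡0⇒≡0ᴷ (p +√ q) N≡0 = by-q (q QP.≟ 0ℚ)
    where
    by-q : Dec (q ≡ 0ℚ) → p +√ q ≡ 0ᴷ
    by-q (yes q≡0) = cong₂ _+√_ (square≡0⇒≡0 (begin
      p * p                        ≡⟨ solve 3 (λ p q D → p :* p := p :* p :- D :* q :* q :+ D :* q :* q) refl p q Dℚ ⟩
      N (p +√ q) + Dℚ * q * q      ≡⟨ cong₂ (λ n q → n + Dℚ * q * q) N≡0 q≡0 ⟩
      0ℚ + Dℚ * 0ℚ * 0ℚ            ≡⟨ solve 1 (λ D → con 0ℚ :+ D :* con 0ℚ :* con 0ℚ := con 0ℚ) refl Dℚ ⟩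
      0ℚ                           ∎)) q≡0
    by-q (no q≢0) = ⊥-elim (nonSquare (p * q * w) (begin
      (p * q * w) * (p * q * w)       ≡⟨ solve 3 (λ p q w → (p :* q :* w) :* (p :* q :* w) := (p :* p) :* q :* q :* w :* w) refl p q w ⟩
      (p * p) * q * q * w * w         ≡⟨ cong (λ r → r * q * q * w * w) pp≡Dqq ⟩
      Dℚ * q * q * q * q * w * w      ≡⟨ solve 3 (λ D q w → D :* q :* q :* q :* q :* w :* w := D :* (q :* q :* w) :* (q :* q :* w)) refl Dℚ q w ⟩
      Dℚ * (q * q * w) * (q * q * w)  ≡⟨ cong (λ r → Dℚ * r * r) *-inverse ⟩
      Dℚ * 1ℚ * 1ℚ                    ≡⟨ solve 1 (λ D → D :* con 1ℚ :* con 1ℚ := D) refl Dℚ ⟩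
      Dℚ                              ∎))
      where
      open PositiveInverse (positiveInverse (square-pos q≢0)) renaming (inverse to w)
      pp≡Dqq : p * p ≡ Dℚ * q * q
      pp≡Dqq = trans (solve 3 (λ p q D → p :* p := (p :* p :- D :* q :* q) :+ D :* q :* q) refl p q Dℚ)
                     (trans (cong (_+ Dℚ * q * q) N≡0) (QP.+-identityˡ _))

  0≮N-of-pure-√ : ∀ q → ¬ (0ℚ < N (0ℚ +√ q))
  0≮N-of-pure-√ q 0<N = 0≮0 (subst (0ℚ <_)
    (solve 2 (λ q D → (con 0ℚ :* con 0ℚ :- D :* q :* q) :+ D :* (q :* q) := con 0ℚ) refl q Dℚ)
    (pos+nonNeg 0<N (nonNeg*nonNeg (QP.<⇒≤ 0<D) (square-nonNeg q))))

  N≮0-of-rational : ∀ p → ¬ (N (p +√ 0ℚ) < 0ℚ)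
  N≮0-of-rational p N<0 = QP.<-irrefl refl (QP.<-≤-trans N<0
    (subst (0ℚ ≤_) (solve 2 (λ p D → p :* p := p :* p :- D :* con 0ℚ :* con 0ℚ) refl p Dℚ) (square-nonNeg p)))

  -- If N z > 0 then z and its conjugate have the same sign, which is that of their
  -- mean re z; if N z < 0 they have opposite signs and z has the sign of im z.
  PosN : K → Set
  PosN z = (0ℚ < N z × 0ℚ < re z) ⊎ (N z < 0ℚ × 0ℚ < im z)

  Pos⇒PosN : ∀ z → Pos z → PosN z
  Pos⇒PosN (p +√ q) (inj₁ (0≤p , 0≤q , 0<p⊎0<q)) = by-sign-of-N (QP.<-cmp 0ℚ (N (p +√ q)))
    where
    by-sign-of-N : Tri (0ℚ < N (p +√ q)) (0ℚ ≡ N (p +√ q)) (N (p +√ q) < 0ℚ) → PosN (p +√ q)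
    by-sign-of-N (tri< 0<N _ _) = inj₁ (0<N , [ (λ 0<p → 0<p) , (λ _ → nonNeg∧≢0⇒pos 0≤p
      (λ p≡0 → 0≮N-of-pure-√ q (subst (λ p → 0ℚ < N (p +√ q)) p≡0 0<N))) ]′ 0<p⊎0<q)
    by-sign-of-N (tri≈ _ 0≡N _) = ⊥-elim ([ (λ 0<p → 0≮0 (subst (0ℚ <_) (cong re z≡0) 0<p))
                                            , (λ 0<q → 0≮0 (subst (0ℚ <_) (cong im z≡0) 0<q)) ]′ 0<p⊎0<q)
      where
      z≡0 = N≡0⇒≡0ᴷ (p +√ q) (sym 0≡N)
    by-sign-of-N (tri> _ _ N<0) = inj₂ (N<0 , nonNeg∧≢0⇒pos 0≤q
      (λ q≡0 → N≮0-of-rational p (subst (λ q → N (p +√ q) < 0ℚ) q≡0 N<0)))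
  Pos⇒PosN (p +√ q) (inj₂ (inj₁ (0<p , _ , Dqq<pp))) = inj₁ (<⇒0<- Dqq<pp , 0<p)
  Pos⇒PosN (p +√ q) (inj₂ (inj₂ (_ , 0<q , pp<Dqq))) =
    inj₂ (0<-⇒< (subst (0ℚ <_) (solve 3 (λ p q D → D :* q :* q :- p :* p := con 0ℚ :- (p :* p :- D :* q :* q)) refl p q Dℚ) (<⇒0<- pp<Dqq)) , 0<q)

  PosN⇒Pos : ∀ z → PosN z → Pos z
  PosN⇒Pos (p +√ q) (inj₁ (0<N , 0<p)) = by-sign-of-q (QP.<-cmp 0ℚ q)
    where
    by-sign-of-q : Tri (0ℚ < q) (0ℚ ≡ q) (q < 0ℚ) → Pos (p +√ q)
    by-sign-of-q (tri< 0<q _ _) = inj₁ (QP.<⇒≤ 0<p , QP.<⇒≤ 0<q , inj₁ 0<p)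
    by-sign-of-q (tri≈ _ 0≡q _) = inj₁ (QP.<⇒≤ 0<p , QP.≤-reflexive 0≡q , inj₁ 0<p)
    by-sign-of-q (tri> _ _ q<0) = inj₂ (inj₁ (0<p , q<0 , 0<-⇒< 0<N))
  PosN⇒Pos (p +√ q) (inj₂ (N<0 , 0<q)) = by-sign-of-p (QP.<-cmp 0ℚ p)
    where
    by-sign-of-p : Tri (0ℚ < p) (0ℚ ≡ p) (p < 0ℚ) → Pos (p +√ q)
    by-sign-of-p (tri< 0<p _ _) = inj₁ (QP.<⇒≤ 0<p , QP.<⇒≤ 0<q , inj₂ 0<q)
    by-sign-of-p (tri≈ _ 0≡p _) = inj₁ (QP.≤-reflexive 0≡p , QP.<⇒≤ 0<q , inj₂ 0<q)
    by-sign-of-p (tri> _ _ p<0) = inj₂ (inj₂ (p<0 , 0<q , 0<-⇒< (subst (0ℚ <_)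
      (solve 3 (λ p q D → con 0ℚ :- (p :* p :- D :* q :* q) := D :* q :* q :- p :* p) refl p q Dℚ) (<⇒0<- N<0))))

  -- In each case the deciding coordinate P of x ⊗ y is positive by pos*∧pos+⇒pos: its product
  -- with the conjugate combination P′ is a positive combination of the norms, and P + P′ > 0.
  PosN-⊗ : ∀ x y → PosN x → PosN y → PosN (x ⊗ y)
  PosN-⊗ x@(p +√ q) y@(r +√ s) (inj₁ (0<Nx , 0<p)) (inj₁ (0<Ny , 0<r)) =
    inj₁ (subst (0ℚ <_) (sym (N-⊗ x y)) (pos*pos 0<Nx 0<Ny) , pos*∧pos+⇒pos
      (subst (0ℚ <_) (solve 5 (λ p q r s D → p :* p :* (r :* r :- D :* s :* s) :+ D :* (s :* s) :* (p :* p :- D :* q :* q)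
                                          := (p :* r :+ D :* q :* s) :* (p :* r :- D :* q :* s)) refl p q r s Dℚ)
        (pos+nonNeg (pos*pos (pos*pos 0<p 0<p) 0<Ny) (nonNeg*nonNeg (nonNeg*nonNeg (QP.<⇒≤ 0<D) (square-nonNeg s)) (QP.<⇒≤ 0<Nx))))
      (subst (0ℚ <_) (solve 5 (λ p q r s D → p :* r :+ p :* r := (p :* r :+ D :* q :* s) :+ (p :* r :- D :* q :* s)) refl p q r s Dℚ)
        (pos+pos (pos*pos 0<p 0<r) (pos*pos 0<p 0<r))))
  PosN-⊗ x@(p +√ q) y@(r +√ s) (inj₁ (0<Nx , 0<p)) (inj₂ (Ny<0 , 0<s)) =
    inj₂ (subst₂ _<_ (sym (N-⊗ x y)) (QP.*-zeroʳ (N x)) (QP.*-monoʳ-<-pos (N x) {{ℚ.positive 0<Nx}} Ny<0) , pos*∧pos+⇒pos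
      (subst (0ℚ <_) (solve 5 (λ p q r s D → s :* s :* (p :* p :- D :* q :* q) :+ q :* q :* (con 0ℚ :- (r :* r :- D :* s :* s))
                                          := (p :* s :+ q :* r) :* (p :* s :- q :* r)) refl p q r s Dℚ)
        (pos+nonNeg (pos*pos (pos*pos 0<s 0<s) 0<Nx) (nonNeg*nonNeg (square-nonNeg q) (QP.<⇒≤ (<⇒0<- Ny<0)))))
      (subst (0ℚ <_) (solve 4 (λ p q r s → p :* s :+ p :* s := (p :* s :+ q :* r) :+ (p :* s :- q :* r)) refl p q r s)
        (pos+pos (pos*pos 0<p 0<s) (pos*pos 0<p 0<s))))
  PosN-⊗ x y (inj₂ Nx<0∧0<q) (inj₁ 0<Ny∧0<r) =
    subst PosN (⊗-comm y x) (PosN-⊗ y x (inj₁ 0<Ny∧0<r) (inj₂ Nx<0∧0<q))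
  PosN-⊗ x@(p +√ q) y@(r +√ s) (inj₂ (Nx<0 , 0<q)) (inj₂ (Ny<0 , 0<s)) =
    inj₁ (subst (0ℚ <_) (trans (solve 2 (λ a b → (con 0ℚ :- a) :* (con 0ℚ :- b) := a :* b) refl (N x) (N y)) (sym (N-⊗ x y)))
            (pos*pos (<⇒0<- Nx<0) (<⇒0<- Ny<0)) , pos*∧pos+⇒pos
      (subst (0ℚ <_) (solve 5 (λ p q r s D → D :* (q :* q) :* (con 0ℚ :- (r :* r :- D :* s :* s)) :+ r :* r :* (con 0ℚ :- (p :* p :- D :* q :* q))
                                          := (p :* r :+ D :* q :* s) :* (D :* q :* s :- p :* r)) refl p q r s Dℚ)
        (pos+nonNeg (pos*pos (pos*pos 0<D (pos*pos 0<q 0<q)) (<⇒0<- Ny<0)) (nonNeg*nonNeg (square-nonNeg r) (QP.<⇒≤ (<⇒0<- Nx<0)))))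
      (subst (0ℚ <_) (solve 5 (λ p q r s D → D :* q :* s :+ D :* q :* s := (p :* r :+ D :* q :* s) :+ (D :* q :* s :- p :* r)) refl p q r s Dℚ)
        (pos+pos (pos*pos (pos*pos 0<D 0<q) 0<s) (pos*pos (pos*pos 0<D 0<q) 0<s))))

  Pos-⊗ : ∀ {x y} → Pos x → Pos y → Pos (x ⊗ y)
  Pos-⊗ {x} {y} 0<x 0<y = PosN⇒Pos (x ⊗ y) (PosN-⊗ x y (Pos⇒PosN x 0<x) (Pos⇒PosN y 0<y))

  -- p + q√D > 0 exactly when s ↦ p + q s is positive at a rational point below √D
  -- and at one above it; this turns closure under addition into rational arithmetic.
  at : K → ℚ → ℚ
  at z s = re z + im z * s

  record Bracket (z : K) : Set where
    field
      lower upper : ℚ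
      0≤lower     : 0ℚ ≤ lower
      0<upper     : 0ℚ < upper
      lower²<D    : lower * lower < Dℚ
      D<upper²    : Dℚ < upper * upper
      at-lower    : 0ℚ < at z lower
      at-upper    : 0ℚ < at z upper

  ≤-across-√D : ∀ {l u} → 0ℚ ≤ l → 0ℚ < u → l * l < Dℚ → Dℚ < u * u → l ≤ u
  ≤-across-√D {l} {u} 0≤l 0<u ll<D D<uu = [ (λ l≤u → l≤u) , (λ u≤l → ⊥-elim (QP.<-irrefl refl (QP.<-≤-trans (QP.<-trans ll<D D<uu)
    (0≤-⇒≤ (subst (0ℚ ≤_) (solve 2 (λ l u → (l :- u) :* (l :+ u) := l :* l :- u :* u) refl l u)
      (nonNeg*nonNeg (≤⇒0≤- u≤l) (nonNeg+nonNeg 0≤l (QP.<⇒≤ 0<u)))))))) ]′ (QP.≤-total l u)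

  at-between : ∀ z {l u s} → l ≤ s → s ≤ u → 0ℚ < at z l → 0ℚ < at z u → 0ℚ < at z s
  at-between (p +√ q) {l} {u} {s} l≤s s≤u 0<at-l 0<at-u = [ 0≤q⇒ , q≤0⇒ ]′ (QP.≤-total 0ℚ q)
    where
    0≤q⇒ : 0ℚ ≤ q → 0ℚ < p + q * s
    0≤q⇒ 0≤q = subst (0ℚ <_) (solve 4 (λ p q l s → (p :+ q :* l) :+ q :* (s :- l) := p :+ q :* s) refl p q l s)
      (pos+nonNeg 0<at-l (nonNeg*nonNeg 0≤q (≤⇒0≤- l≤s)))
    q≤0⇒ : q ≤ 0ℚ → 0ℚ < p + q * s
    q≤0⇒ q≤0 = subst (0ℚ <_) (solve 4 (λ p q u s → (p :+ q :* u) :+ (:- q) :* (u :- s) := p :+ q :* s) refl p q u s)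
      (pos+nonNeg 0<at-u (nonNeg*nonNeg (QP.neg-antimono-≤ q≤0) (≤⇒0≤- s≤u)))

  at-⊕ : ∀ x y s → at x s + at y s ≡ at (x ⊕ y) s
  at-⊕ (p +√ q) (r +√ t) s =
    solve 5 (λ p q r t s → (p :+ q :* s) :+ (r :+ t :* s) := (p :+ r) :+ (q :+ t) :* s) refl p q r t s

  ⊔-closed : (P : ℚ → Set) → ∀ {a b} → P a → P b → P (a ⊔ b)
  ⊔-closed P {a} {b} Pa Pb = [ (λ e → subst P (sym e) Pa) , (λ e → subst P (sym e) Pb) ]′ (QP.⊔-sel a b)

  ⊓-closed : (P : ℚ → Set) → ∀ {a b} → P a → P b → P (a ⊓ b)
  ⊓-closed P {a} {b} Pa Pb = [ (λ e → subst P (sym e) Pa) , (λ e → subst P (sym e) Pb) ]′ (QP.⊓-sel a b)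

  Bracket-⊕ : ∀ {x y} → Bracket x → Bracket y → Bracket (x ⊕ y)
  Bracket-⊕ {x} {y} bx by = record
    { lower    = l
    ; upper    = u
    ; 0≤lower  = QP.≤-trans (X.0≤lower) (QP.p≤p⊔q X.lower Y.lower)
    ; 0<upper  = ⊓-closed (0ℚ <_) {X.upper} {Y.upper} X.0<upper Y.0<upper
    ; lower²<D = ⊔-closed (λ s → s * s < Dℚ) {X.lower} {Y.lower} X.lower²<D Y.lower²<D
    ; D<upper² = ⊓-closed (λ s → Dℚ < s * s) {X.upper} {Y.upper} X.D<upper² Y.D<upper²
    ; at-lower = subst (0ℚ <_) (at-⊕ x y l) (pos+pos
        (at-between x (QP.p≤p⊔q X.lower Y.lower) (QP.⊔-lub (X≤ X.0≤lower X.lower²<D) (X≤ Y.0≤lower Y.lower²<D)) X.at-lower X.at-upper)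
        (at-between y (QP.p≤q⊔p X.lower Y.lower) (QP.⊔-lub (Y≤ X.0≤lower X.lower²<D) (Y≤ Y.0≤lower Y.lower²<D)) Y.at-lower Y.at-upper))
    ; at-upper = subst (0ℚ <_) (at-⊕ x y u) (pos+pos
        (at-between x (QP.⊓-glb (X≤ X.0≤lower X.lower²<D) (Y≤ X.0≤lower X.lower²<D)) (QP.p⊓q≤p X.upper Y.upper) X.at-lower X.at-upper)
        (at-between y (QP.⊓-glb (X≤ Y.0≤lower Y.lower²<D) (Y≤ Y.0≤lower Y.lower²<D)) (QP.p⊓q≤q X.upper Y.upper) Y.at-lower Y.at-upper)) }
    where
    module X = Bracket bx
    module Y = Bracket by
    l = X.lower ⊔ Y.lower
    u = X.upper ⊓ Y.upper
    X≤ : ∀ {s} → 0ℚ ≤ s → s * s < Dℚ → s ≤ X.upper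
    X≤ 0≤s ss<D = ≤-across-√D 0≤s X.0<upper ss<D X.D<upper²
    Y≤ : ∀ {s} → 0ℚ ≤ s → s * s < Dℚ → s ≤ Y.upper
    Y≤ 0≤s ss<D = ≤-across-√D 0≤s Y.0<upper ss<D Y.D<upper²

  Bracket⇒Pos : ∀ z → Bracket z → Pos z
  Bracket⇒Pos (p +√ q) b = by-sign-of-q (QP.<-cmp 0ℚ q)
    where
    open Bracket b
    by-sign-of-q : Tri (0ℚ < q) (0ℚ ≡ q) (q < 0ℚ) → Pos (p +√ q)
    by-sign-of-q (tri< 0<q _ _) = by-sign-of-p (QP.<-cmp 0ℚ p)
      where
      by-sign-of-p : Tri (0ℚ < p) (0ℚ ≡ p) (p < 0ℚ) → Pos (p +√ q)
      by-sign-of-p (tri< 0<p _ _) = inj₁ (QP.<⇒≤ 0<p , QP.<⇒≤ 0<q , inj₂ 0<q)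
      by-sign-of-p (tri≈ _ 0≡p _) = inj₁ (QP.≤-reflexive 0≡p , QP.<⇒≤ 0<q , inj₂ 0<q)
      by-sign-of-p (tri> _ _ p<0) = inj₂ (inj₂ (p<0 , 0<q , 0<-⇒< (subst (0ℚ <_)
        (solve 4 (λ p q l D → q :* q :* (D :- l :* l) :+ (p :+ q :* l) :* (q :* l :- p) := D :* q :* q :- p :* p) refl p q lower Dℚ)
        (pos+pos (pos*pos (pos*pos 0<q 0<q) (<⇒0<- lower²<D))
                 (pos*pos at-lower (nonNeg+pos (nonNeg*nonNeg (QP.<⇒≤ 0<q) 0≤lower) (QP.neg-antimono-< p<0)))))))
    by-sign-of-q (tri≈ _ 0≡q _) = inj₁ (QP.<⇒≤ 0<p , QP.≤-reflexive 0≡q , inj₁ 0<p)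
      where
      0<p : 0ℚ < p
      0<p = subst (0ℚ <_) (solve 2 (λ p l → p :+ con 0ℚ :* l := p) refl p lower) (subst (λ q → 0ℚ < p + q * lower) (sym 0≡q) at-lower)
    by-sign-of-q (tri> _ _ q<0) = inj₂ (inj₁ (0<p , q<0 , 0<-⇒< (subst (0ℚ <_)
        (solve 4 (λ p q u D → (p :+ q :* u) :* (p :+ (:- q) :* u) :+ (:- q) :* (:- q) :* (u :* u :- D) := p :* p :- D :* q :* q) refl p q upper Dℚ)
        (pos+pos (pos*pos at-upper (pos+pos 0<p -qu>0)) (pos*pos (pos*pos -q>0 -q>0) (<⇒0<- D<upper²))))))
      where
      -q>0 = QP.neg-antimono-< q<0
      -qu>0 = pos*pos -q>0 0<upper
      0<p : 0ℚ < p
      0<p = subst (0ℚ <_) (solve 3 (λ p q u → (p :+ q :* u) :+ (:- q) :* u := p) refl p q upper) (pos+pos at-upper -qu>0)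

  -- A Newton step towards √D from above.
  approx-√D-from-above : ∀ {m} → 0ℚ < m → Dℚ < m * m → ∃ λ u → 0ℚ < u × Dℚ < u * u × u < m
  approx-√D-from-above {m} 0<m D<mm = u , 0<u , 0<-⇒< D<uu , 0<-⇒< u<m
    where
    open PositiveInverse (positiveInverse (pos+pos 0<m 0<m)) renaming (inverse to w)
    u = (m * m + Dℚ) * w
    0<u = pos*pos (pos+pos (pos*pos 0<m 0<m) 0<D) inverse-pos
    0<mm-D = <⇒0<- D<mm
    u<m : 0ℚ < m - u
    u<m = subst (0ℚ <_) (sym (begin
      m - u                                              ≡⟨ solve 3 (λ m D w → m :- (m :* m :+ D) :* w := (m :* m :- D) :* w :+ m :* (con 1ℚ :- (m :+ m) :* w)) refl m Dℚ w ⟩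
      (m * m - Dℚ) * w + m * (1ℚ - (m + m) * w)          ≡⟨ cong (λ e → (m * m - Dℚ) * w + m * (1ℚ - e)) *-inverse ⟩
      (m * m - Dℚ) * w + m * (1ℚ - 1ℚ)                   ≡⟨ solve 3 (λ m D w → (m :* m :- D) :* w :+ m :* (con 1ℚ :- con 1ℚ) := (m :* m :- D) :* w) refl m Dℚ w ⟩
      (m * m - Dℚ) * w                                   ∎)) (pos*pos 0<mm-D inverse-pos)
    D<uu : 0ℚ < u * u - Dℚ
    D<uu = subst (0ℚ <_) (sym (begin
      u * u - Dℚ                                                             ≡⟨ solve 3 (λ m D w → (m :* m :+ D) :* w :* ((m :* m :+ D) :* w) :- D
                                                                                   := (m :* m :- D) :* (m :* m :- D) :* w :* w :+ D :* ((m :+ m) :* w :- con 1ℚ) :* ((m :+ m) :* w :+ con 1ℚ)) refl m Dℚ w ⟩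
      (m * m - Dℚ) * (m * m - Dℚ) * w * w + Dℚ * ((m + m) * w - 1ℚ) * ((m + m) * w + 1ℚ)  ≡⟨ cong (λ e → (m * m - Dℚ) * (m * m - Dℚ) * w * w + Dℚ * (e - 1ℚ) * (e + 1ℚ)) *-inverse ⟩
      (m * m - Dℚ) * (m * m - Dℚ) * w * w + Dℚ * (1ℚ - 1ℚ) * (1ℚ + 1ℚ)                  ≡⟨ solve 3 (λ m D w → (m :* m :- D) :* (m :* m :- D) :* w :* w :+ D :* (con 1ℚ :- con 1ℚ) :* (con 1ℚ :+ con 1ℚ) := (m :* m :- D) :* (m :* m :- D) :* w :* w) refl m Dℚ w ⟩
      (m * m - Dℚ) * (m * m - Dℚ) * w * w                                    ∎)) (pos*pos (pos*pos (pos*pos 0<mm-D 0<mm-D) inverse-pos) inverse-pos)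

  -- The harmonic mean of m and D/m, which lies strictly between m and √D.
  approx-√D-from-below : ∀ {m} → 0ℚ < m → m * m < Dℚ → ∃ λ l → 0ℚ ≤ l × l * l < Dℚ × m < l
  approx-√D-from-below {m} 0<m mm<D = l , QP.<⇒≤ 0<l , 0<-⇒< ll<D , 0<-⇒< m<l
    where
    open PositiveInverse (positiveInverse (pos+pos (pos*pos 0<m 0<m) 0<D)) renaming (inverse to v)
    l = (m + m) * Dℚ * v
    0<l = pos*pos (pos*pos (pos+pos 0<m 0<m) 0<D) inverse-pos
    0<D-mm = <⇒0<- mm<D
    m<l : 0ℚ < l - m
    m<l = subst (0ℚ <_) (sym (begin
      l - m                                               ≡⟨ solve 3 (λ m D v → (m :+ m) :* D :* v :- m := m :* (D :- m :* m) :* v :+ m :* ((m :* m :+ D) :* v :- con 1ℚ)) refl m Dℚ v ⟩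
      m * (Dℚ - m * m) * v + m * ((m * m + Dℚ) * v - 1ℚ)  ≡⟨ cong (λ e → m * (Dℚ - m * m) * v + m * (e - 1ℚ)) *-inverse ⟩
      m * (Dℚ - m * m) * v + m * (1ℚ - 1ℚ)                ≡⟨ solve 3 (λ m D v → m :* (D :- m :* m) :* v :+ m :* (con 1ℚ :- con 1ℚ) := m :* (D :- m :* m) :* v) refl m Dℚ v ⟩
      m * (Dℚ - m * m) * v                                ∎)) (pos*pos (pos*pos 0<m 0<D-mm) inverse-pos)
    ll<D : 0ℚ < Dℚ - l * l
    ll<D = subst (0ℚ <_) (sym (begin
      Dℚ - l * l                                                                    ≡⟨ solve 3 (λ m D v → D :- (m :+ m) :* D :* v :* ((m :+ m) :* D :* v)
                                                                                          := D :* (D :- m :* m) :* (D :- m :* m) :* v :* v :+ D :* (con 1ℚ :- (m :* m :+ D) :* v) :* (con 1ℚ :+ (m :* m :+ D) :* v)) refl m Dℚ v ⟩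
      Dℚ * (Dℚ - m * m) * (Dℚ - m * m) * v * v + Dℚ * (1ℚ - (m * m + Dℚ) * v) * (1ℚ + (m * m + Dℚ) * v)  ≡⟨ cong (λ e → Dℚ * (Dℚ - m * m) * (Dℚ - m * m) * v * v + Dℚ * (1ℚ - e) * (1ℚ + e)) *-inverse ⟩
      Dℚ * (Dℚ - m * m) * (Dℚ - m * m) * v * v + Dℚ * (1ℚ - 1ℚ) * (1ℚ + 1ℚ)      ≡⟨ solve 3 (λ m D v → D :* (D :- m :* m) :* (D :- m :* m) :* v :* v :+ D :* (con 1ℚ :- con 1ℚ) :* (con 1ℚ :+ con 1ℚ) := D :* (D :- m :* m) :* (D :- m :* m) :* v :* v) refl m Dℚ v ⟩
      Dℚ * (Dℚ - m * m) * (Dℚ - m * m) * v * v                                      ∎)) (pos*pos (pos*pos (pos*pos (pos*pos 0<D 0<D-mm) 0<D-mm) inverse-pos) inverse-pos)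

  0<D+1 : 0ℚ < Dℚ + 1ℚ
  0<D+1 = pos+pos 0<D 0<1

  D<[D+1]² : Dℚ < (Dℚ + 1ℚ) * (Dℚ + 1ℚ)
  D<[D+1]² = 0<-⇒< (subst (0ℚ <_) (solve 1 (λ D → D :* D :+ D :+ con 1ℚ := (D :+ con 1ℚ) :* (D :+ con 1ℚ) :- D) refl Dℚ)
    (nonNeg+pos (nonNeg+nonNeg (square-nonNeg Dℚ) (QP.<⇒≤ 0<D)) 0<1))

  Pos⇒Bracket : ∀ z → Pos z → Bracket z
  Pos⇒Bracket (p +√ q) (inj₁ (0≤p , 0≤q , 0<p⊎0<q)) = record
    { lower = 1ℚ ; upper = Dℚ + 1ℚ ; 0≤lower = QP.<⇒≤ 0<1 ; 0<upper = 0<D+1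
    ; lower²<D = 1<D ; D<upper² = D<[D+1]²
    ; at-lower = subst (0ℚ <_) (solve 2 (λ p q → p :+ q := p :+ q :* con 1ℚ) refl p q)
        ([ (λ 0<p → pos+nonNeg 0<p 0≤q) , nonNeg+pos 0≤p ]′ 0<p⊎0<q)
    ; at-upper = [ (λ 0<p → pos+nonNeg 0<p (nonNeg*nonNeg 0≤q (QP.<⇒≤ 0<D+1))) , (λ 0<q → nonNeg+pos 0≤p (pos*pos 0<q 0<D+1)) ]′ 0<p⊎0<q }
  Pos⇒Bracket (p +√ q) (inj₂ (inj₁ (0<p , q<0 , Dqq<pp))) = bracket (approx-√D-from-above 0<m D<mm)
    where
    open PositiveInverse (positiveInverse (QP.neg-antimono-< q<0)) renaming (inverse to w)
    m = p * w
    0<m = pos*pos 0<p inverse-pos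
    D<mm : Dℚ < m * m
    D<mm = 0<-⇒< (subst (0ℚ <_) (sym (begin
      m * m - Dℚ                                                          ≡⟨ solve 4 (λ p q D w → p :* w :* (p :* w) :- D := (p :* p :- D :* q :* q) :* w :* w :+ D :* ((:- q) :* w :- con 1ℚ) :* ((:- q) :* w :+ con 1ℚ)) refl p q Dℚ w ⟩
      (p * p - Dℚ * q * q) * w * w + Dℚ * ((- q) * w - 1ℚ) * ((- q) * w + 1ℚ)  ≡⟨ cong (λ e → (p * p - Dℚ * q * q) * w * w + Dℚ * (e - 1ℚ) * (e + 1ℚ)) *-inverse ⟩
      (p * p - Dℚ * q * q) * w * w + Dℚ * (1ℚ - 1ℚ) * (1ℚ + 1ℚ)          ≡⟨ solve 4 (λ p q D w → (p :* p :- D :* q :* q) :* w :* w :+ D :* (con 1ℚ :- con 1ℚ) :* (con 1ℚ :+ con 1ℚ) := (p :* p :- D :* q :* q) :* w :* w) refl p q Dℚ w ⟩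
      (p * p - Dℚ * q * q) * w * w                                        ∎)) (pos*pos (pos*pos (<⇒0<- Dqq<pp) inverse-pos) inverse-pos))
    bracket : (∃ λ u → 0ℚ < u × Dℚ < u * u × u < m) → Bracket (p +√ q)
    bracket (u , 0<u , D<uu , u<m) = record
      { lower = 0ℚ ; upper = u ; 0≤lower = QP.≤-refl ; 0<upper = 0<u
      ; lower²<D = 0<D ; D<upper² = D<uu
      ; at-lower = subst (0ℚ <_) (solve 2 (λ p q → p := p :+ q :* con 0ℚ) refl p q) 0<p
      ; at-upper = subst (0ℚ <_) (sym (begin
          p + q * u                             ≡⟨ solve 4 (λ p q u w → p :+ q :* u := (:- q) :* (p :* w :- u) :+ p :* (con 1ℚ :- (:- q) :* w)) refl p q u w ⟩
          (- q) * (m - u) + p * (1ℚ - (- q) * w)  ≡⟨ cong (λ e → (- q) * (m - u) + p * (1ℚ - e)) *-inverse ⟩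
          (- q) * (m - u) + p * (1ℚ - 1ℚ)         ≡⟨ solve 4 (λ p q u w → (:- q) :* (p :* w :- u) :+ p :* (con 1ℚ :- con 1ℚ) := (:- q) :* (p :* w :- u)) refl p q u w ⟩
          (- q) * (m - u)                       ∎)) (pos*pos (QP.neg-antimono-< q<0) (<⇒0<- u<m)) }
  Pos⇒Bracket (p +√ q) (inj₂ (inj₂ (p<0 , 0<q , pp<Dqq))) = bracket (approx-√D-from-below 0<m mm<D)
    where
    open PositiveInverse (positiveInverse 0<q) renaming (inverse to w)
    m = (- p) * w
    0<m = pos*pos (QP.neg-antimono-< p<0) inverse-pos
    mm<D : m * m < Dℚ
    mm<D = 0<-⇒< (subst (0ℚ <_) (sym (begin
      Dℚ - m * m                                                    ≡⟨ solve 4 (λ p q D w → D :- (:- p) :* w :* ((:- p) :* w) := (D :* q :* q :- p :* p) :* w :* w :+ D :* (con 1ℚ :- q :* w) :* (con 1ℚ :+ q :* w)) refl p q Dℚ w ⟩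
      (Dℚ * q * q - p * p) * w * w + Dℚ * (1ℚ - q * w) * (1ℚ + q * w)  ≡⟨ cong (λ e → (Dℚ * q * q - p * p) * w * w + Dℚ * (1ℚ - e) * (1ℚ + e)) *-inverse ⟩
      (Dℚ * q * q - p * p) * w * w + Dℚ * (1ℚ - 1ℚ) * (1ℚ + 1ℚ)      ≡⟨ solve 4 (λ p q D w → (D :* q :* q :- p :* p) :* w :* w :+ D :* (con 1ℚ :- con 1ℚ) :* (con 1ℚ :+ con 1ℚ) := (D :* q :* q :- p :* p) :* w :* w) refl p q Dℚ w ⟩
      (Dℚ * q * q - p * p) * w * w                                  ∎)) (pos*pos (pos*pos (<⇒0<- pp<Dqq) inverse-pos) inverse-pos))
    bracket : (∃ λ l → 0ℚ ≤ l × l * l < Dℚ × m < l) → Bracket (p +√ q)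
    bracket (l , 0≤l , ll<D , m<l) = record
      { lower = l ; upper = Dℚ + 1ℚ ; 0≤lower = 0≤l ; 0<upper = 0<D+1
      ; lower²<D = ll<D ; D<upper² = D<[D+1]²
      ; at-lower = at-l
      ; at-upper = subst (0ℚ <_) (solve 4 (λ p q l D → (p :+ q :* l) :+ q :* (D :+ con 1ℚ :- l) := p :+ q :* (D :+ con 1ℚ)) refl p q l Dℚ)
          (pos+nonNeg at-l (nonNeg*nonNeg (QP.<⇒≤ 0<q) (≤⇒0≤- (≤-across-√D 0≤l 0<D+1 ll<D D<[D+1]²)))) }
      where
      at-l : 0ℚ < p + q * l
      at-l = subst (0ℚ <_) (sym (begin
        p + q * l                           ≡⟨ solve 4 (λ p q l w → p :+ q :* l := q :* (l :- (:- p) :* w) :+ p :* (con 1ℚ :- q :* w)) refl p q l w ⟩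
        q * (l - m) + p * (1ℚ - q * w)      ≡⟨ cong (λ e → q * (l - m) + p * (1ℚ - e)) *-inverse ⟩
        q * (l - m) + p * (1ℚ - 1ℚ)         ≡⟨ solve 4 (λ p q l w → q :* (l :- (:- p) :* w) :+ p :* (con 1ℚ :- con 1ℚ) := q :* (l :- (:- p) :* w)) refl p q l w ⟩
        q * (l - m)                         ∎)) (pos*pos 0<q (<⇒0<- m<l))

  Pos-⊕ : ∀ {x y} → Pos x → Pos y → Pos (x ⊕ y)
  Pos-⊕ {x} {y} 0<x 0<y = Bracket⇒Pos (x ⊕ y) (Bracket-⊕ (Pos⇒Bracket x 0<x) (Pos⇒Bracket y 0<y))

  ¬Pos-0ᴷ : ¬ Pos 0ᴷ
  ¬Pos-0ᴷ (inj₁ (_ , _ , inj₁ 0<0)) = 0≮0 0<0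
  ¬Pos-0ᴷ (inj₁ (_ , _ , inj₂ 0<0)) = 0≮0 0<0
  ¬Pos-0ᴷ (inj₂ (inj₁ (0<0 , _))) = 0≮0 0<0
  ¬Pos-0ᴷ (inj₂ (inj₂ (_ , 0<0 , _))) = 0≮0 0<0

  Pos-trichotomy : ∀ z → z ≡ 0ᴷ ⊎ Pos z ⊎ Pos (⊝ z)
  Pos-trichotomy z@(p +√ q) = by-sign-of-N (QP.<-cmp 0ℚ (N z))
    where
    by-sign-of-N : Tri (0ℚ < N z) (0ℚ ≡ N z) (N z < 0ℚ) → z ≡ 0ᴷ ⊎ Pos z ⊎ Pos (⊝ z)
    by-sign-of-N (tri≈ _ 0≡N _) = inj₁ (N≡0⇒≡0ᴷ z (sym 0≡N))
    by-sign-of-N (tri< 0<N _ _) = by-sign-of-p (QP.<-cmp 0ℚ p)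
      where
      by-sign-of-p : Tri (0ℚ < p) (0ℚ ≡ p) (p < 0ℚ) → z ≡ 0ᴷ ⊎ Pos z ⊎ Pos (⊝ z)
      by-sign-of-p (tri< 0<p _ _) = inj₂ (inj₁ (PosN⇒Pos z (inj₁ (0<N , 0<p))))
      by-sign-of-p (tri> _ _ p<0) = inj₂ (inj₂ (PosN⇒Pos (⊝ z) (inj₁ (subst (0ℚ <_) (sym (N-⊝ z)) 0<N , QP.neg-antimono-< p<0))))
      by-sign-of-p (tri≈ _ 0≡p _) = ⊥-elim (0≮N-of-pure-√ q (subst (λ p → 0ℚ < N (p +√ q)) (sym 0≡p) 0<N))
    by-sign-of-N (tri> _ _ N<0) = by-sign-of-q (QP.<-cmp 0ℚ q)
      where
      by-sign-of-q : Tri (0ℚ < q) (0ℚ ≡ q) (q < 0ℚ) → z ≡ 0ᴷ ⊎ Pos z ⊎ Pos (⊝ z)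
      by-sign-of-q (tri< 0<q _ _) = inj₂ (inj₁ (PosN⇒Pos z (inj₂ (N<0 , 0<q))))
      by-sign-of-q (tri> _ _ q<0) = inj₂ (inj₂ (PosN⇒Pos (⊝ z) (inj₂ (subst (_< 0ℚ) (sym (N-⊝ z)) N<0 , QP.neg-antimono-< q<0))))
      by-sign-of-q (tri≈ _ 0≡q _) = ⊥-elim (N≮0-of-rational p (subst (λ q → N (p +√ q) < 0ℚ) (sym 0≡q) N<0))


≤⇒≡⊎< : ∀ {m n} → m ℤ.≤ n → m ≡ n ⊎ m ℤ.< n
≤⇒≡⊎< {m} {n} m≤n with m ℤ.≟ n
... | yes m≡n = inj₁ m≡n
... | no m≢n  = inj₂ (ℤP.≤∧≢⇒< m≤n m≢n)

module Order (D : ℕ) (nonSquare : NonSquare D) where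
  open QuadraticField D
  open Positivity D nonSquare using (Pos-⊕; Pos-⊗; ¬Pos-0ᴷ; Pos-trichotomy; 0<1) public
  open K-Solver using (solve; _:+_; _:-_; _:*_; :-_; con; _:=_)

  NonNeg : K → Set
  NonNeg z = z ≡ 0ᴷ ⊎ Pos z

  Pos⇒NonNeg : ∀ {z} → Pos z → NonNeg z
  Pos⇒NonNeg = inj₂

  Pos-⊕-NonNeg : ∀ {x y} → Pos x → NonNeg y → Pos (x ⊕ y)
  Pos-⊕-NonNeg {x} 0<x (inj₁ refl) = subst Pos (sym (⊕-identityʳ x)) 0<x
  Pos-⊕-NonNeg 0<x (inj₂ 0<y) = Pos-⊕ 0<x 0<y

  NonNeg-⊕-Pos : ∀ {x y} → NonNeg x → Pos y → Pos (x ⊕ y)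
  NonNeg-⊕-Pos {x} {y} 0≤x 0<y = subst Pos (⊕-comm y x) (Pos-⊕-NonNeg 0<y 0≤x)

  NonNeg-⊗ : ∀ {x y} → NonNeg x → NonNeg y → NonNeg (x ⊗ y)
  NonNeg-⊗ {y = y} (inj₁ refl) _ = inj₁ (⊗-zeroˡ y)
  NonNeg-⊗ {x} (inj₂ _) (inj₁ refl) = inj₁ (trans (⊗-comm x 0ᴷ) (⊗-zeroˡ x))
  NonNeg-⊗ (inj₂ 0<x) (inj₂ 0<y) = inj₂ (Pos-⊗ 0<x 0<y)

  Pos-asym : ∀ {z} → Pos z → ¬ Pos (⊝ z)
  Pos-asym {z} 0<z 0<-z = ¬Pos-0ᴷ (subst Pos (solve 1 (λ z → z :+ (:- z) := con (+ 0)) refl z) (Pos-⊕ 0<z 0<-z))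

  Pos-cancelˡ : ∀ {k x} → Pos k → Pos (k ⊗ x) → Pos x
  Pos-cancelˡ {k} {x} 0<k 0<kx = [ x≡0⇒⊥ , [ (λ 0<x → 0<x) , -x>0⇒⊥ ]′ ]′ (Pos-trichotomy x)
    where
    x≡0⇒⊥ : x ≡ 0ᴷ → Pos x
    x≡0⇒⊥ x≡0 = ⊥-elim (¬Pos-0ᴷ (subst Pos (trans (cong (k ⊗_) x≡0) (trans (⊗-comm k 0ᴷ) (⊗-zeroˡ k))) 0<kx))
    -x>0⇒⊥ : Pos (⊝ x) → Pos x
    -x>0⇒⊥ 0<-x = ⊥-elim (Pos-asym 0<kx (subst Pos (solve 2 (λ k x → k :* (:- x) := :- (k :* x)) refl k x) (Pos-⊗ 0<k 0<-x)))

  ≤ᴷ⇒NonNeg : ∀ {x y} → x ≤ᴷ y → NonNeg (y ⊖ x)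
  ≤ᴷ⇒NonNeg {x} (inj₁ refl) = inj₁ (solve 1 (λ x → x :- x := con (+ 0)) refl x)
  ≤ᴷ⇒NonNeg (inj₂ x<y) = inj₂ x<y

  Pos-ι : ∀ {r} → 0ℚ < r → Pos (ι r)
  Pos-ι 0<r = inj₁ (QP.<⇒≤ 0<r , QP.≤-refl , inj₁ 0<r)

  Pos-ι⁻¹ : ∀ {r} → Pos (ι r) → 0ℚ < r
  Pos-ι⁻¹ (inj₁ (_ , _ , inj₁ 0<r)) = 0<r
  Pos-ι⁻¹ (inj₁ (_ , _ , inj₂ 0<0)) = ⊥-elim (QP.<-irrefl refl 0<0)
  Pos-ι⁻¹ (inj₂ (inj₁ (_ , 0<0 , _))) = ⊥-elim (QP.<-irrefl refl 0<0)
  Pos-ι⁻¹ (inj₂ (inj₂ (_ , 0<0 , _))) = ⊥-elim (QP.<-irrefl refl 0<0)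

  Pos-ιℤ : ∀ {z} → + 0 ℤ.< z → Pos (ιℤ z)
  Pos-ιℤ {z} 0<z = Pos-ι (ℤ→ℚ-Properties.ℤ→ℚ-mono-< {+ 0} {z} 0<z)

  Pos-ιℤ⁻¹ : ∀ {z} → Pos (ιℤ z) → + 0 ℤ.< z
  Pos-ιℤ⁻¹ 0<z = ℤ→ℚ-Properties.ℤ→ℚ-cancel-< (Pos-ι⁻¹ 0<z)

  NonNeg-ιℤ : ∀ {z} → + 0 ℤ.≤ z → NonNeg (ιℤ z)
  NonNeg-ιℤ {+ zero} _ = inj₁ refl
  NonNeg-ιℤ {ℤ.+[1+ n ]} _ = inj₂ (Pos-ιℤ {ℤ.+[1+ n ]} (ℤ.+<+ (ℕ.s≤s ℕ.z≤n)))

  ιℤ-cancel-< : ∀ {m n} → Pos (ιℤ n ⊖ ιℤ m) → m ℤ.< n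
  ιℤ-cancel-< m<n = ℤ→ℚ-Properties.ℤ→ℚ-cancel-< (ℚ-Order.0<-⇒< (Pos-ι⁻¹ m<n))

  ιℤ-cancel-<-+1 : ∀ {m n} → Pos (ιℤ n ⊕ 1ᴷ ⊖ ιℤ m) → m ℤ.≤ n
  ιℤ-cancel-<-+1 {m} {n} m<n+1 = subst (m ℤ.≤_) (trans (cong ℤ.pred (ℤP.+-comm n (+ 1))) (ℤP.pred-suc n))
    (ℤP.i<j⇒i≤pred[j] (ιℤ-cancel-< {m} {n ℤ.+ + 1} (subst (λ e → Pos (e ⊖ ιℤ m)) (sym (ιℤ-+ n (+ 1))) m<n+1)))

  IsFloor-unique : ∀ {y k l} → IsFloor y k → IsFloor y l → k ≡ l
  IsFloor-unique {y} {k} {l} (k≤y , y<k+1) (l≤y , y<l+1) = ℤP.≤-antisym (below k≤y y<l+1) (below l≤y y<k+1)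
    where
    below : ∀ {k l} → ιℤ k ≤ᴷ y → y <ᴷ ιℤ (l ℤ.+ + 1) → k ℤ.≤ l
    below {k} {l} k≤y y<l+1 = ιℤ-cancel-<-+1 (subst Pos (solve 3 (λ l y k → (l :+ con (+ 1) :- y) :+ (y :- k) := l :+ con (+ 1) :- k) refl (ιℤ l) y (ιℤ k))
      (Pos-⊕-NonNeg (subst (λ e → Pos (e ⊖ y)) (ιℤ-+ l (+ 1)) y<l+1) (≤ᴷ⇒NonNeg k≤y)))

  record Within (B z : K) : Set where
    constructor within
    field
      z<B  : Pos (B ⊖ z)
      -B<z : Pos (B ⊕ z)

  Within-⊖ : ∀ {B C x y} → Within B x → Within C y → Within (B ⊕ C) (x ⊖ y)
  Within-⊖ {B} {C} {x} {y} (within x<B -B<x) (within y<C -C<y) = within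
    (subst Pos (solve 4 (λ B C x y → (B :- x) :+ (C :+ y) := (B :+ C) :- (x :- y)) refl B C x y) (Pos-⊕ x<B -C<y))
    (subst Pos (solve 4 (λ B C x y → (B :+ x) :+ (C :- y) := (B :+ C) :+ (x :- y)) refl B C x y) (Pos-⊕ -B<x y<C))

  Within-⊗ : ∀ {k B x} → Pos k → Within B x → Within (k ⊗ B) (k ⊗ x)
  Within-⊗ {k} {B} {x} 0<k (within x<B -B<x) = within
    (subst Pos (solve 3 (λ k B x → k :* (B :- x) := k :* B :- k :* x) refl k B x) (Pos-⊗ 0<k x<B))
    (subst Pos (solve 3 (λ k B x → k :* (B :+ x) := k :* B :+ k :* x) refl k B x) (Pos-⊗ 0<k -B<x))

  Within-weaken : ∀ {B C x} → NonNeg (C ⊖ B) → Within B x → Within C x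
  Within-weaken {B} {C} {x} B≤C (within x<B -B<x) = within
    (subst Pos (solve 3 (λ B C x → (B :- x) :+ (C :- B) := C :- x) refl B C x) (Pos-⊕-NonNeg x<B B≤C))
    (subst Pos (solve 3 (λ B C x → (B :+ x) :+ (C :- B) := C :+ x) refl B C x) (Pos-⊕-NonNeg -B<x B≤C))

  Within⇒Pos : ∀ {B x} → Within B x → Pos B
  Within⇒Pos {B} {x} (within x<B -B<x) = Pos-cancelˡ (Pos-ιℤ {+ 2} (ℤ.+<+ (ℕ.s≤s ℕ.z≤n)))
    (subst Pos (solve 2 (λ B x → (B :- x) :+ (B :+ x) := con (+ 2) :* B) refl B x) (Pos-⊕ x<B -B<x))

  Within-cancel : ∀ {k B x} → NonNeg (k ⊖ 1ᴷ) → Within B (x ⊗ k) → Within B x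
  Within-cancel {k} {B} {x} 1≤k w@(within xk<B -B<xk) = within
    (Pos-cancelˡ 0<k (subst Pos (solve 3 (λ k B x → (B :- x :* k) :+ B :* (k :- con (+ 1)) := k :* (B :- x)) refl k B x) (Pos-⊕-NonNeg xk<B B[k-1])))
    (Pos-cancelˡ 0<k (subst Pos (solve 3 (λ k B x → (B :+ x :* k) :+ B :* (k :- con (+ 1)) := k :* (B :+ x)) refl k B x) (Pos-⊕-NonNeg -B<xk B[k-1])))
    where
    0<k : Pos k
    0<k = subst Pos (solve 1 (λ k → (k :- con (+ 1)) :+ con (+ 1) := k) refl k) (NonNeg-⊕-Pos 1≤k (Pos-ι 0<1))
    B[k-1] : NonNeg (B ⊗ (k ⊖ 1ᴷ))
    B[k-1] = NonNeg-⊗ (Pos⇒NonNeg (Within⇒Pos w)) 1≤k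

  Within-ιℤ : ∀ {M z} → Within (ιℤ M) (ιℤ z) → ℤ.- M ℤ.< z × z ℤ.< M
  Within-ιℤ {M} {z} (within z<M -M<z) =
    ιℤ-cancel-< (subst Pos (trans (solve 2 (λ M z → M :+ z := z :- (:- M)) refl (ιℤ M) (ιℤ z)) (cong (ιℤ z ⊖_) (sym (ιℤ-⊝ M)))) -M<z) ,
    ιℤ-cancel-< z<M

  <⇒Pos-ιℤ : ∀ {m n} → m ℤ.< n → Pos (ιℤ n ⊖ ιℤ m)
  <⇒Pos-ιℤ m<n = Pos-ι (ℚ-Order.<⇒0<- (ℤ→ℚ-Properties.ℤ→ℚ-mono-< m<n))

  ≤⇒NonNeg-ιℤ : ∀ {m n} → m ℤ.≤ n → NonNeg (ιℤ n ⊖ ιℤ m)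
  ≤⇒NonNeg-ιℤ {m} {n} m≤n = [ m≡n⇒0 , (λ m<n → inj₂ (<⇒Pos-ιℤ m<n)) ]′ (≤⇒≡⊎< m≤n)
    where
    m≡n⇒0 : m ≡ n → NonNeg (ιℤ n ⊖ ιℤ m)
    m≡n⇒0 refl = inj₁ (solve 1 (λ m → m :- m := con (+ 0)) refl (ιℤ m))

  <⇒NonNeg-ιℤ-1 : ∀ {m n} → m ℤ.< n → NonNeg (ιℤ n ⊖ 1ᴷ ⊖ ιℤ m)
  <⇒NonNeg-ιℤ-1 {m} {n} m<n = subst NonNeg
    (trans (cong (ιℤ n ⊖_) (ιℤ-+ (+ 1) m)) (solve 2 (λ n m → n :- (con (+ 1) :+ m) := n :- con (+ 1) :- m) refl (ιℤ n) (ιℤ m)))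
    (≤⇒NonNeg-ιℤ (ℤP.i<j⇒suc[i]≤j m<n))

  ⊗-cancelˡ-Pos : ∀ {k x y} → Pos k → k ⊗ x ≡ k ⊗ y → x ≡ y
  ⊗-cancelˡ-Pos {k} {x} {y} 0<k kx≡ky = [ x-y≡0⇒x≡y , [ (λ 0<x-y → ⊥-elim (¬Pos-0ᴷ (subst Pos k[x-y]≡0 (Pos-⊗ 0<k 0<x-y))))
                                                       , (λ 0<y-x → ⊥-elim (¬Pos-0ᴷ (subst Pos k[y-x]≡0 (Pos-⊗ 0<k 0<y-x)))) ]′ ]′
                                          (Pos-trichotomy (x ⊖ y))
    where
    x-y≡0⇒x≡y : x ⊖ y ≡ 0ᴷ → x ≡ y
    x-y≡0⇒x≡y x-y≡0 = trans (solve 2 (λ x y → x := (x :- y) :+ y) refl x y) (trans (cong (_⊕ y) x-y≡0) (⊕-identityˡ y))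
    k[x-y]≡0 : k ⊗ (x ⊖ y) ≡ 0ᴷ
    k[x-y]≡0 = trans (solve 3 (λ k x y → k :* (x :- y) := k :* x :- k :* y) refl k x y)
                     (trans (cong (_⊖ k ⊗ y) kx≡ky) (solve 2 (λ k y → k :* y :- k :* y := con (+ 0)) refl k y))
    k[y-x]≡0 : k ⊗ (⊝ (x ⊖ y)) ≡ 0ᴷ
    k[y-x]≡0 = trans (solve 3 (λ k x y → k :* (:- (x :- y)) := k :* y :- k :* x) refl k x y)
                     (trans (cong (_⊖ k ⊗ x) (sym kx≡ky)) (solve 2 (λ k x → k :* x :- k :* x := con (+ 0)) refl k x))


module _ {A : Set} (t : ℕ → A) where

  periodic-from-return : (∀ i j → t i ≡ t j → t (suc i) ≡ t (suc j)) →
                         ∀ N → t 0 ≡ t N → ∀ k → t (N ℕ.+ k) ≡ t k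
  periodic-from-return step N t0≡tN zero = trans (cong t (ℕP.+-identityʳ N)) (sym t0≡tN)
  periodic-from-return step N t0≡tN (suc k) =
    trans (cong t (ℕP.+-suc N k)) (step (N ℕ.+ k) k (periodic-from-return step N t0≡tN k))

  return-from-repeat : (∀ i j → t (suc i) ≡ t (suc j) → t i ≡ t j) →
                       ∀ {i j} → i ℕ.< j → t i ≡ t j → ∃ λ N → 0 ℕ.< N × t 0 ≡ t N
  return-from-repeat unstep {i} {j} i<j ti≡tj with ℕP.m≤n⇒∃[o]m+o≡n i<j
  ... | o , i+1+o≡j = suc o , ℕ.s≤s ℕ.z≤n ,
    cancel i (trans (cong t (ℕP.+-identityʳ i)) (trans ti≡tj (cong t (trans (sym i+1+o≡j) (sym (ℕP.+-suc i o))))))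
    where
    cancel : ∀ k {m n} → t (k ℕ.+ m) ≡ t (k ℕ.+ n) → t m ≡ t n
    cancel zero e = e
    cancel (suc k) e = cancel k (unstep (k ℕ.+ _) (k ℕ.+ _) e)

module _ (M : ℕ) where

  Bounded : (ℕ → ℤ) → Set
  Bounded h = ∀ n → ℤ.- + M ℤ.< h n × h n ℤ.< + M

  private
    shift-nonNeg : ∀ {z} → ℤ.- + M ℤ.< z → + 0 ℤ.≤ z ℤ.+ + M
    shift-nonNeg {z} -M<z = ℤP.<⇒≤ (subst (ℤ._< z ℤ.+ + M) (ℤP.+-inverseˡ (+ M)) (ℤP.+-monoˡ-< (+ M) -M<z))

    shift-bounded : ∀ {z} → ℤ.- + M ℤ.< z → z ℤ.< + M → ℤ.∣ z ℤ.+ + M ∣ ℕ.< M ℕ.+ M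
    shift-bounded {z} -M<z z<M = ℤP.drop‿+<+ (subst (ℤ._< + (M ℕ.+ M)) (sym (ℤP.0≤i⇒+∣i∣≡i (shift-nonNeg -M<z))) (ℤP.+-monoˡ-< (+ M) z<M))

    code : ∀ h → Bounded h → ℕ → Fin (M ℕ.+ M)
    code h bounded n = fromℕ< (shift-bounded (proj₁ (bounded n)) (proj₂ (bounded n)))

    code-injective : ∀ h (bounded : Bounded h) {m n} → code h bounded m ≡ code h bounded n → h m ≡ h n
    code-injective h bounded {m} {n} codes≡ = +-cancelʳ (+ M) (h m) (h n) (begin
      h m ℤ.+ + M                  ≡⟨ sym (ℤP.0≤i⇒+∣i∣≡i (shift-nonNeg (proj₁ (bounded m)))) ⟩
      + ℤ.∣ h m ℤ.+ + M ∣          ≡⟨ cong +_ (FinP.fromℕ<-injective _ _ _ _ codes≡) ⟩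
      + ℤ.∣ h n ℤ.+ + M ∣          ≡⟨ ℤP.0≤i⇒+∣i∣≡i (shift-nonNeg (proj₁ (bounded n))) ⟩
      h n ℤ.+ + M                  ∎)
      where open ≡-Reasoning

  bounded-pairs-repeat : ∀ f g → Bounded f → Bounded g → ∃₂ λ i j → i ℕ.< j × f i ≡ f j × g i ≡ g j
  bounded-pairs-repeat f g f-bounded g-bounded
    with i , j , i<j , codes≡ ← FinP.pigeonhole (ℕP.n<1+n ((M ℕ.+ M) ℕ.* (M ℕ.+ M)))
                                   (λ k → combine (code f f-bounded (toℕ k)) (code g g-bounded (toℕ k)))
    with f-codes≡ , g-codes≡ ← FinP.combine-injective (code f f-bounded (toℕ i)) (code g g-bounded (toℕ i))
                                                      (code f f-bounded (toℕ j)) (code g g-bounded (toℕ j)) codes≡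
    = toℕ i , toℕ j , i<j , code-injective f f-bounded f-codes≡ , code-injective g g-bounded g-codes≡


module PisotUnit (D : ℕ) (nonSquare : NonSquare D) (β : K) (pisot : QD.QuadPisotUnitPosConj D β) where
  open QuadraticField D
  open Order D nonSquare
  open QuadPisotUnitPosConj pisot
  open K-Solver using (solve; _:+_; _:-_; _:*_; :-_; con; _:=_)
  open ≡-Reasoning

  β′ : K
  β′ = conj β

  a : ℤ
  a = proj₁ traceInt

  β+β′≡a : β ⊕ β′ ≡ ιℤ a
  β+β′≡a = cong₂ _+√_ (proj₂ traceInt) (QP.+-inverseʳ (im β))

  1<β : Pos (β ⊖ 1ᴷ)
  1<β = gt1

  0<β : Pos β
  0<β = subst Pos (solve 1 (λ b → (b :- con (+ 1)) :+ con (+ 1) := b) refl β) (Pos-⊕ 1<β (Pos-ι 0<1))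

  0<β′ : Pos β′
  0<β′ = subst Pos (solve 1 (λ b → b :- con (+ 0) := b) refl β′) conjPos

  β′<1 : Pos (1ᴷ ⊖ β′)
  β′<1 = proj₂ conjSmall

  -- The norm is ±1, and it is positive because both conjugates are.
  ββ′≡1 : β ⊗ β′ ≡ 1ᴷ
  ββ′≡1 = [ ββ′≡ι , (λ N≡-1 → ⊥-elim (QP.<-asym (Pos-ι⁻¹ (subst Pos (ββ′≡ι N≡-1) (Pos-⊗ 0<β 0<β′))) (QP.neg-antimono-< 0<1))) ]′ normUnit
    where
    ββ′≡ι : ∀ {r} → re (β ⊗ β′) ≡ r → β ⊗ β′ ≡ ι r
    ββ′≡ι N≡r = trans (⊗-conj β) (cong ι (trans (sym (cong re (⊗-conj β))) N≡r))

  β²≡aβ-1 : β ⊗ β ≡ ιℤ a ⊗ β ⊖ 1ᴷ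
  β²≡aβ-1 = begin
    β ⊗ β                    ≡⟨ solve 2 (λ b b′ → b :* b := (b :+ b′) :* b :- b :* b′) refl β β′ ⟩
    (β ⊕ β′) ⊗ β ⊖ β ⊗ β′    ≡⟨ cong₂ (λ A n → A ⊗ β ⊖ n) β+β′≡a ββ′≡1 ⟩
    ιℤ a ⊗ β ⊖ 1ᴷ            ∎

  2<a : + 2 ℤ.< a
  2<a = ιℤ-cancel-< (subst Pos (begin
    (β ⊖ 1ᴷ) ⊗ (1ᴷ ⊖ β′)             ≡⟨ solve 2 (λ b b′ → (b :- con (+ 1)) :* (con (+ 1) :- b′) := (b :+ b′) :- b :* b′ :- con (+ 1)) refl β β′ ⟩
    (β ⊕ β′) ⊖ β ⊗ β′ ⊖ 1ᴷ           ≡⟨ cong₂ (λ A n → A ⊖ n ⊖ 1ᴷ) β+β′≡a ββ′≡1 ⟩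
    ιℤ a ⊖ 1ᴷ ⊖ 1ᴷ                   ≡⟨ solve 1 (λ A → A :- con (+ 1) :- con (+ 1) := A :- con (+ 2)) refl (ιℤ a) ⟩
    ιℤ a ⊖ ιℤ (+ 2)                  ∎) (Pos-⊗ 1<β β′<1))

  2<β : Pos (β ⊖ ιℤ (+ 2))
  2<β = subst Pos (begin
    (ιℤ (a ℤ.- + 3)) ⊕ (1ᴷ ⊖ β′)         ≡⟨ cong (_⊕ (1ᴷ ⊖ β′)) (ιℤ-⊖ a (+ 3)) ⟩
    (ιℤ a ⊖ ιℤ (+ 3)) ⊕ (1ᴷ ⊖ β′)        ≡⟨ cong (λ A → (A ⊖ ιℤ (+ 3)) ⊕ (1ᴷ ⊖ β′)) (sym β+β′≡a) ⟩
    ((β ⊕ β′) ⊖ ιℤ (+ 3)) ⊕ (1ᴷ ⊖ β′)    ≡⟨ solve 2 (λ b b′ → ((b :+ b′) :- con (+ 3)) :+ (con (+ 1) :- b′) := b :- con (+ 2)) refl β β′ ⟩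
    β ⊖ ιℤ (+ 2)                         ∎) (NonNeg-⊕-Pos (NonNeg-ιℤ (ℤP.i≤j⇒0≤j-i (ℤP.i<j⇒suc[i]≤j 2<a))) β′<1)

module _ (D : ℕ) (nonSquare : NonSquare D) where
  open QuadraticField D
  open Order D nonSquare
  open K-Solver using (solve; _:+_; _:-_; _:*_; :-_; con; _:=_)
  open ≡-Reasoning

  module NegBetaOrbit (β : K) (pisot : QuadPisotUnitPosConj β) (c : K) (c[β+1]≡β : c ⊗ (β ⊕ 1ᴷ) ≡ β)
                      (x : ℚ) (x∈I : (⊝ c) ≤ᴷ ι x × ι x <ᴷ (1ᴷ ⊖ c))
                      (t : ℕ → K) (d : ℕ → ℤ) (expansion : IsNegBetaExpansion β c (ι x) t d) where
    open PisotUnit D nonSquare β pisot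
    open IsNegBetaExpansion expansion

    βc≡β-c : β ⊗ c ≡ β ⊖ c
    βc≡β-c = begin
      β ⊗ c                    ≡⟨ solve 2 (λ b c → b :* c := c :* (b :+ con (+ 1)) :- c) refl β c ⟩
      c ⊗ (β ⊕ 1ᴷ) ⊖ c         ≡⟨ cong (_⊖ c) c[β+1]≡β ⟩
      β ⊖ c                    ∎

    c[1+β′]≡1 : c ⊗ (1ᴷ ⊕ β′) ≡ 1ᴷ
    c[1+β′]≡1 = begin
      c ⊗ (1ᴷ ⊕ β′)            ≡⟨ cong (λ u → c ⊗ (u ⊕ β′)) (sym ββ′≡1) ⟩
      c ⊗ (β ⊗ β′ ⊕ β′)        ≡⟨ solve 3 (λ c b b′ → c :* (b :* b′ :+ b′) := c :* (b :+ con (+ 1)) :* b′) refl c β β′ ⟩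
      c ⊗ (β ⊕ 1ᴷ) ⊗ β′        ≡⟨ cong (_⊗ β′) c[β+1]≡β ⟩
      β ⊗ β′                   ≡⟨ ββ′≡1 ⟩
      1ᴷ                       ∎

    0<1+β′ : Pos (1ᴷ ⊕ β′)
    0<1+β′ = Pos-⊕ (Pos-ι 0<1) 0<β′

    0<c : Pos c
    0<c = Pos-cancelˡ 0<1+β′ (subst Pos (sym (trans (⊗-comm (1ᴷ ⊕ β′) c) c[1+β′]≡1)) (Pos-ι 0<1))

    c<1 : Pos (1ᴷ ⊖ c)
    c<1 = Pos-cancelˡ 0<1+β′ (subst Pos (sym (begin
      (1ᴷ ⊕ β′) ⊗ (1ᴷ ⊖ c)        ≡⟨ solve 2 (λ c b′ → (con (+ 1) :+ b′) :* (con (+ 1) :- c) := (con (+ 1) :+ b′) :- c :* (con (+ 1) :+ b′)) refl c β′ ⟩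
      (1ᴷ ⊕ β′) ⊖ c ⊗ (1ᴷ ⊕ β′)   ≡⟨ cong ((1ᴷ ⊕ β′) ⊖_) c[1+β′]≡1 ⟩
      (1ᴷ ⊕ β′) ⊖ 1ᴷ              ≡⟨ solve 1 (λ b′ → (con (+ 1) :+ b′) :- con (+ 1) := b′) refl β′ ⟩
      β′                          ∎)) 0<β′)

    y δ : ℕ → K
    y n = ⊝ β ⊗ t n ⊕ c
    δ n = ιℤ (d n)

    δ≤y : ∀ n → NonNeg (y n ⊖ δ n)
    δ≤y n = ≤ᴷ⇒NonNeg (proj₁ (digit n))

    y<δ+1 : ∀ n → Pos (δ n ⊕ 1ᴷ ⊖ y n)
    y<δ+1 n = subst (λ e → Pos (e ⊖ y n)) (ιℤ-+ (d n) (+ 1)) (proj₂ (digit n))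

    InI : K → Set
    InI u = NonNeg (u ⊕ c) × Pos (1ᴷ ⊖ c ⊖ u)

    orbit-in-I : ∀ n → InI (t n)
    orbit-in-I zero = subst InI (sym start)
      (subst NonNeg (solve 2 (λ x c → x :- (:- c) := x :+ c) refl (ι x) c) (≤ᴷ⇒NonNeg (proj₁ x∈I)) , proj₂ x∈I)
    orbit-in-I (suc n) = subst InI (sym (step n))
      (subst NonNeg (solve 4 (λ b t c δ → ((:- b) :* t :+ c) :- δ := ((:- b) :* t :- δ) :+ c) refl β (t n) c (δ n)) (δ≤y n) ,
      subst Pos (solve 4 (λ b t c δ → δ :+ con (+ 1) :- ((:- b) :* t :+ c) := con (+ 1) :- c :- ((:- b) :* t :- δ)) refl β (t n) c (δ n)) (y<δ+1 n))

    y≡β[1-c-t] : ∀ n → y n ≡ β ⊗ (1ᴷ ⊖ c ⊖ t n)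
    y≡β[1-c-t] n = begin
      ⊝ β ⊗ t n ⊕ c                 ≡⟨ solve 3 (λ b c t → (:- b) :* t :+ c := b :- (b :- c) :- b :* t) refl β c (t n) ⟩
      β ⊖ (β ⊖ c) ⊖ β ⊗ t n         ≡⟨ cong (λ e → β ⊖ e ⊖ β ⊗ t n) (sym βc≡β-c) ⟩
      β ⊖ β ⊗ c ⊖ β ⊗ t n           ≡⟨ solve 3 (λ b c t → b :- b :* c :- b :* t := b :* (con (+ 1) :- c :- t)) refl β c (t n) ⟩
      β ⊗ (1ᴷ ⊖ c ⊖ t n)            ∎

    β-y≡β[t+c] : ∀ n → β ⊖ y n ≡ β ⊗ (t n ⊕ c)
    β-y≡β[t+c] n = begin
      β ⊖ (⊝ β ⊗ t n ⊕ c)           ≡⟨ solve 3 (λ b c t → b :- ((:- b) :* t :+ c) := b :* t :+ (b :- c)) refl β c (t n) ⟩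
      β ⊗ t n ⊕ (β ⊖ c)             ≡⟨ cong (β ⊗ t n ⊕_) (sym βc≡β-c) ⟩
      β ⊗ t n ⊕ β ⊗ c               ≡⟨ solve 3 (λ b c t → b :* t :+ b :* c := b :* (t :+ c)) refl β c (t n) ⟩
      β ⊗ (t n ⊕ c)                 ∎

    0<y : ∀ n → Pos (y n)
    0<y n = subst Pos (sym (y≡β[1-c-t] n)) (Pos-⊗ 0<β (proj₂ (orbit-in-I n)))

    0≤d : ∀ n → + 0 ℤ.≤ d n
    0≤d n = ιℤ-cancel-<-+1 (subst Pos (solve 2 (λ δ y → (δ :+ con (+ 1) :- y) :+ y := δ :+ con (+ 1) :- con (+ 0)) refl (δ n) (y n))
      (Pos-⊕ (y<δ+1 n) (0<y n)))

    d<a : ∀ n → d n ℤ.< a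
    d<a n = ιℤ-cancel-< (subst Pos (begin
      β′ ⊕ (β ⊖ y n) ⊕ (y n ⊖ δ n)   ≡⟨ solve 4 (λ b b′ y δ → b′ :+ (b :- y) :+ (y :- δ) := (b :+ b′) :- δ) refl β β′ (y n) (δ n) ⟩
      (β ⊕ β′) ⊖ δ n                 ≡⟨ cong (_⊖ δ n) β+β′≡a ⟩
      ιℤ a ⊖ δ n                     ∎)
      (Pos-⊕-NonNeg (Pos-⊕-NonNeg 0<β′ (subst NonNeg (sym (β-y≡β[t+c] n)) (NonNeg-⊗ (Pos⇒NonNeg 0<β) (proj₁ (orbit-in-I n))))) (δ≤y n)))

    d-after-largest : ∀ n → ℤ.suc (d n) ≡ a → + 0 ℤ.< d (suc n)
    d-after-largest n d+1≡a = ιℤ-cancel-< (subst Pos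
      (solve 3 (λ δ y k → (δ :+ con (+ 1) :- y) :+ (y :- con (+ 1)) := δ :- con (+ 0)) refl (δ (suc n)) (y (suc n)) (β ⊗ β ⊗ (t n ⊕ c)))
      (Pos-⊕-NonNeg (y<δ+1 (suc n)) (subst NonNeg (sym y′-1≡β²[t+c]) (NonNeg-⊗ (Pos⇒NonNeg (Pos-⊗ 0<β 0<β)) (proj₁ (orbit-in-I n))))))
      where
      δ≡a-1 : δ n ≡ ιℤ a ⊖ 1ᴷ
      δ≡a-1 = begin
        δ n                       ≡⟨ solve 1 (λ δ → δ := con (+ 1) :+ δ :- con (+ 1)) refl (δ n) ⟩
        1ᴷ ⊕ δ n ⊖ 1ᴷ             ≡⟨ cong (_⊖ 1ᴷ) (trans (sym (ιℤ-+ (+ 1) (d n))) (cong ιℤ d+1≡a)) ⟩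
        ιℤ a ⊖ 1ᴷ                 ∎
      y′-1≡β²[t+c] : y (suc n) ⊖ 1ᴷ ≡ β ⊗ β ⊗ (t n ⊕ c)
      y′-1≡β²[t+c] = begin
        ⊝ β ⊗ t (suc n) ⊕ c ⊖ 1ᴷ                           ≡⟨ cong (λ e → ⊝ β ⊗ e ⊕ c ⊖ 1ᴷ) (trans (step n) (cong (⊝ β ⊗ t n ⊖_) δ≡a-1)) ⟩
        ⊝ β ⊗ (⊝ β ⊗ t n ⊖ (ιℤ a ⊖ 1ᴷ)) ⊕ c ⊖ 1ᴷ           ≡⟨ solve 4 (λ b c t A → (:- b) :* ((:- b) :* t :- (A :- con (+ 1))) :+ c :- con (+ 1)
                                                                   := b :* b :* t :+ (A :* b :- con (+ 1)) :- (b :- c)) refl β c (t n) (ιℤ a) ⟩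
        β ⊗ β ⊗ t n ⊕ (ιℤ a ⊗ β ⊖ 1ᴷ) ⊖ (β ⊖ c)           ≡⟨ cong₂ (λ e f → β ⊗ β ⊗ t n ⊕ e ⊖ f) (sym β²≡aβ-1) (sym βc≡β-c) ⟩
        β ⊗ β ⊗ t n ⊕ β ⊗ β ⊖ β ⊗ c                         ≡⟨ solve 3 (λ b c t → b :* b :* t :+ b :* b :- b :* c := b :* b :* t :+ b :* (b :- c)) refl β c (t n) ⟩
        β ⊗ β ⊗ t n ⊕ β ⊗ (β ⊖ c)                           ≡⟨ cong (λ e → β ⊗ β ⊗ t n ⊕ β ⊗ e) (sym βc≡β-c) ⟩
        β ⊗ β ⊗ t n ⊕ β ⊗ (β ⊗ c)                           ≡⟨ solve 3 (λ b c t → b :* b :* t :+ b :* (b :* c) := b :* b :* (t :+ c)) refl β c (t n) ⟩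
        β ⊗ β ⊗ (t n ⊕ c)                                   ∎

    s : ℕ → K
    s n = conj (t n)

    s-step : ∀ n → s (suc n) ≡ ⊝ β′ ⊗ s n ⊖ δ n
    s-step n = trans (cong conj (step n)) (trans (conj-⊕ (⊝ β ⊗ t n) (⊝ δ n)) (cong (_⊕ ⊝ δ n) (conj-⊗ (⊝ β) (t n))))

    -- The conjugate orbit stays in (Lo, Hi): these endpoints are exchanged by the extreme
    -- conjugate branches, Hi = −β′(Lo + 1) and Lo = −β′Hi − (a − 1).
    Hi Lo : K
    Hi = c ⊗ (1ᴷ ⊖ β′)
    Lo = Hi ⊖ β

    Hi[1+β′]≡1-β′ : Hi ⊗ (1ᴷ ⊕ β′) ≡ 1ᴷ ⊖ β′
    Hi[1+β′]≡1-β′ = begin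
      c ⊗ (1ᴷ ⊖ β′) ⊗ (1ᴷ ⊕ β′)       ≡⟨ solve 2 (λ c b′ → c :* (con (+ 1) :- b′) :* (con (+ 1) :+ b′) := c :* (con (+ 1) :+ b′) :* (con (+ 1) :- b′)) refl c β′ ⟩
      c ⊗ (1ᴷ ⊕ β′) ⊗ (1ᴷ ⊖ β′)       ≡⟨ cong (_⊗ (1ᴷ ⊖ β′)) c[1+β′]≡1 ⟩
      1ᴷ ⊗ (1ᴷ ⊖ β′)                  ≡⟨ ⊗-identityˡ (1ᴷ ⊖ β′) ⟩
      1ᴷ ⊖ β′                         ∎

    Hi≡-β′[Lo+1] : Hi ≡ ⊝ β′ ⊗ (Lo ⊕ 1ᴷ)
    Hi≡-β′[Lo+1] = sym (begin
      ⊝ β′ ⊗ (Hi ⊖ β ⊕ 1ᴷ)               ≡⟨ solve 3 (λ h b b′ → (:- b′) :* (h :- b :+ con (+ 1)) := b :* b′ :- b′ :- b′ :* h) refl Hi β β′ ⟩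
      β ⊗ β′ ⊖ β′ ⊖ β′ ⊗ Hi               ≡⟨ cong (λ e → e ⊖ β′ ⊖ β′ ⊗ Hi) ββ′≡1 ⟩
      1ᴷ ⊖ β′ ⊖ β′ ⊗ Hi                   ≡⟨ cong (_⊖ β′ ⊗ Hi) (sym Hi[1+β′]≡1-β′) ⟩
      Hi ⊗ (1ᴷ ⊕ β′) ⊖ β′ ⊗ Hi            ≡⟨ solve 2 (λ h b′ → h :* (con (+ 1) :+ b′) :- b′ :* h := h) refl Hi β′ ⟩
      Hi                                  ∎)

    Lo≡-β′Hi-[a-1] : Lo ≡ ⊝ β′ ⊗ Hi ⊖ (ιℤ a ⊖ 1ᴷ)
    Lo≡-β′Hi-[a-1] = sym (begin
      ⊝ β′ ⊗ Hi ⊖ (ιℤ a ⊖ 1ᴷ)             ≡⟨ cong (λ A → ⊝ β′ ⊗ Hi ⊖ (A ⊖ 1ᴷ)) (sym β+β′≡a) ⟩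
      ⊝ β′ ⊗ Hi ⊖ (β ⊕ β′ ⊖ 1ᴷ)           ≡⟨ solve 3 (λ h b b′ → (:- b′) :* h :- (b :+ b′ :- con (+ 1)) := (con (+ 1) :- b′) :- b′ :* h :- b) refl Hi β β′ ⟩
      (1ᴷ ⊖ β′) ⊖ β′ ⊗ Hi ⊖ β             ≡⟨ cong (λ e → e ⊖ β′ ⊗ Hi ⊖ β) (sym Hi[1+β′]≡1-β′) ⟩
      Hi ⊗ (1ᴷ ⊕ β′) ⊖ β′ ⊗ Hi ⊖ β        ≡⟨ solve 3 (λ h b b′ → h :* (con (+ 1) :+ b′) :- b′ :* h :- b := h :- b) refl Hi β β′ ⟩
      Hi ⊖ β                              ∎)

    Lo+1<-c : Pos (⊝ c ⊖ (Lo ⊕ 1ᴷ))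
    Lo+1<-c = Pos-cancelˡ 0<1+β′ (subst Pos (sym (begin
      (1ᴷ ⊕ β′) ⊗ (⊝ c ⊖ (Hi ⊖ β ⊕ 1ᴷ))                                    ≡⟨ solve 4 (λ c h b b′ → (con (+ 1) :+ b′) :* ((:- c) :- (h :- b :+ con (+ 1)))
                                                                                := b :+ b :* b′ :- c :* (con (+ 1) :+ b′) :- h :* (con (+ 1) :+ b′) :- (con (+ 1) :+ b′)) refl c Hi β β′ ⟩
      β ⊕ β ⊗ β′ ⊖ c ⊗ (1ᴷ ⊕ β′) ⊖ Hi ⊗ (1ᴷ ⊕ β′) ⊖ (1ᴷ ⊕ β′)           ≡⟨ cong₂ (λ e f → β ⊕ e ⊖ f ⊖ Hi ⊗ (1ᴷ ⊕ β′) ⊖ (1ᴷ ⊕ β′)) ββ′≡1 c[1+β′]≡1 ⟩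
      β ⊕ 1ᴷ ⊖ 1ᴷ ⊖ Hi ⊗ (1ᴷ ⊕ β′) ⊖ (1ᴷ ⊕ β′)                           ≡⟨ cong (λ e → β ⊕ 1ᴷ ⊖ 1ᴷ ⊖ e ⊖ (1ᴷ ⊕ β′)) Hi[1+β′]≡1-β′ ⟩
      β ⊕ 1ᴷ ⊖ 1ᴷ ⊖ (1ᴷ ⊖ β′) ⊖ (1ᴷ ⊕ β′)                                 ≡⟨ solve 2 (λ b b′ → b :+ con (+ 1) :- con (+ 1) :- (con (+ 1) :- b′) :- (con (+ 1) :+ b′) := b :- con (+ 2)) refl β β′ ⟩
      β ⊖ ιℤ (+ 2)                                                          ∎)) 2<β)

    1-c<Hi : Pos (Hi ⊖ (1ᴷ ⊖ c))
    1-c<Hi = Pos-cancelˡ 0<1+β′ (subst Pos (sym (begin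
      (1ᴷ ⊕ β′) ⊗ (Hi ⊖ (1ᴷ ⊖ c))                                   ≡⟨ solve 3 (λ c h b′ → (con (+ 1) :+ b′) :* (h :- (con (+ 1) :- c))
                                                                          := h :* (con (+ 1) :+ b′) :- (con (+ 1) :+ b′) :+ c :* (con (+ 1) :+ b′)) refl c Hi β′ ⟩
      Hi ⊗ (1ᴷ ⊕ β′) ⊖ (1ᴷ ⊕ β′) ⊕ c ⊗ (1ᴷ ⊕ β′)                    ≡⟨ cong₂ (λ e f → e ⊖ (1ᴷ ⊕ β′) ⊕ f) Hi[1+β′]≡1-β′ c[1+β′]≡1 ⟩
      (1ᴷ ⊖ β′) ⊖ (1ᴷ ⊕ β′) ⊕ 1ᴷ                                   ≡⟨ cong ((1ᴷ ⊖ β′) ⊖ (1ᴷ ⊕ β′) ⊕_) (sym ββ′≡1) ⟩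
      (1ᴷ ⊖ β′) ⊖ (1ᴷ ⊕ β′) ⊕ β ⊗ β′                               ≡⟨ solve 2 (λ b b′ → (con (+ 1) :- b′) :- (con (+ 1) :+ b′) :+ b :* b′ := b′ :* (b :- con (+ 2))) refl β β′ ⟩
      β′ ⊗ (β ⊖ ιℤ (+ 2))                                           ∎)) (Pos-⊗ 0<β′ 2<β))

    step-Lo : ∀ n → s (suc n) ⊖ Lo ≡ β′ ⊗ (Hi ⊖ s n) ⊕ (ιℤ a ⊖ 1ᴷ ⊖ δ n)
    step-Lo n = begin
      s (suc n) ⊖ Lo                                        ≡⟨ cong₂ _⊖_ (s-step n) Lo≡-β′Hi-[a-1] ⟩
      (⊝ β′ ⊗ s n ⊖ δ n) ⊖ (⊝ β′ ⊗ Hi ⊖ (ιℤ a ⊖ 1ᴷ))       ≡⟨ solve 5 (λ b′ s δ h A → ((:- b′) :* s :- δ) :- ((:- b′) :* h :- (A :- con (+ 1)))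
                                                                   := b′ :* (h :- s) :+ (A :- con (+ 1) :- δ)) refl β′ (s n) (δ n) Hi (ιℤ a) ⟩
      β′ ⊗ (Hi ⊖ s n) ⊕ (ιℤ a ⊖ 1ᴷ ⊖ δ n)                   ∎

    step-Hi : ∀ n → Hi ⊖ s (suc n) ≡ β′ ⊗ (s n ⊖ (Lo ⊕ 1ᴷ)) ⊕ δ n
    step-Hi n = begin
      Hi ⊖ s (suc n)                                  ≡⟨ cong₂ _⊖_ Hi≡-β′[Lo+1] (s-step n) ⟩
      ⊝ β′ ⊗ (Lo ⊕ 1ᴷ) ⊖ (⊝ β′ ⊗ s n ⊖ δ n)          ≡⟨ solve 4 (λ b′ s δ l → (:- b′) :* (l :+ con (+ 1)) :- ((:- b′) :* s :- δ) := b′ :* (s :- (l :+ con (+ 1))) :+ δ) refl β′ (s n) (δ n) Lo ⟩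
      β′ ⊗ (s n ⊖ (Lo ⊕ 1ᴷ)) ⊕ δ n                    ∎

    InConjDomain : K → ℤ → Set
    InConjDomain u k = Pos (u ⊖ Lo) × Pos (Hi ⊖ u) × (k ≡ + 0 → Pos (u ⊖ (Lo ⊕ 1ᴷ)))

    -- Digit 0 may only be produced from the part of (Lo, Hi) above Lo + 1; this is
    -- what keeps the conjugate orbit below Hi.
    conj-orbit-bounded : ∀ n → InConjDomain (s n) (d n)
    conj-orbit-bounded zero = subst (λ u → InConjDomain u (d 0)) (sym (cong conj start)) (
      subst Pos (solve 2 (λ x l → (x :- (l :+ con (+ 1))) :+ con (+ 1) := x :- l) refl (ι x) Lo) (Pos-⊕ x>Lo+1 (Pos-ι 0<1)) ,
      subst Pos (solve 3 (λ h c x → (h :- (con (+ 1) :- c)) :+ (con (+ 1) :- c :- x) := h :- x) refl Hi c (ι x)) (Pos-⊕ 1-c<Hi (proj₂ x∈I)) ,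
      λ _ → x>Lo+1)
      where
      x>Lo+1 : Pos (ι x ⊖ (Lo ⊕ 1ᴷ))
      x>Lo+1 = subst Pos (solve 3 (λ x c l → (x :- (:- c)) :+ ((:- c) :- l) := x :- l) refl (ι x) c (Lo ⊕ 1ᴷ))
                 (NonNeg-⊕-Pos (≤ᴷ⇒NonNeg (proj₁ x∈I)) Lo+1<-c)
    conj-orbit-bounded (suc n) = conj-step (conj-orbit-bounded n)
      where
      conj-step : InConjDomain (s n) (d n) → InConjDomain (s (suc n)) (d (suc n))
      conj-step (s>Lo , s<Hi , d≡0⇒s>Lo+1) = above-Lo , below-Hi , above-Lo+1
        where
        above-Lo : Pos (s (suc n) ⊖ Lo)
        above-Lo = subst Pos (sym (step-Lo n)) (Pos-⊕-NonNeg (Pos-⊗ 0<β′ s<Hi) (<⇒NonNeg-ιℤ-1 (d<a n)))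

        below-Hi : Pos (Hi ⊖ s (suc n))
        below-Hi = [ digit-zero , digit-positive ]′ (≤⇒≡⊎< (0≤d n))
          where
          digit-zero : + 0 ≡ d n → Pos (Hi ⊖ s (suc n))
          digit-zero 0≡d = subst Pos (sym (step-Hi n)) (Pos-⊕-NonNeg (Pos-⊗ 0<β′ (d≡0⇒s>Lo+1 (sym 0≡d))) (NonNeg-ιℤ (0≤d n)))
          digit-positive : + 0 ℤ.< d n → Pos (Hi ⊖ s (suc n))
          digit-positive 0<d = subst Pos (sym (trans (step-Hi n)
              (solve 4 (λ b′ s δ l → b′ :* (s :- (l :+ con (+ 1))) :+ δ := b′ :* (s :- l) :+ (δ :- con (+ 1) :- con (+ 0)) :+ (con (+ 1) :- b′)) refl β′ (s n) (δ n) Lo)))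
            (Pos-⊕ (Pos-⊕-NonNeg (Pos-⊗ 0<β′ s>Lo) (<⇒NonNeg-ιℤ-1 0<d)) β′<1)

        above-Lo+1 : d (suc n) ≡ + 0 → Pos (s (suc n) ⊖ (Lo ⊕ 1ᴷ))
        above-Lo+1 d′≡0 = subst Pos (sym (begin
            s (suc n) ⊖ (Lo ⊕ 1ᴷ)                                       ≡⟨ solve 2 (λ s l → s :- (l :+ con (+ 1)) := (s :- l) :- con (+ 1)) refl (s (suc n)) Lo ⟩
            (s (suc n) ⊖ Lo) ⊖ 1ᴷ                                       ≡⟨ cong (_⊖ 1ᴷ) (step-Lo n) ⟩
            β′ ⊗ (Hi ⊖ s n) ⊕ (ιℤ a ⊖ 1ᴷ ⊖ δ n) ⊖ 1ᴷ                     ≡⟨ solve 5 (λ b′ h s A δ → b′ :* (h :- s) :+ (A :- con (+ 1) :- δ) :- con (+ 1)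
                                                                               := b′ :* (h :- s) :+ (A :- con (+ 1) :- (con (+ 1) :+ δ))) refl β′ Hi (s n) (ιℤ a) (δ n) ⟩
            β′ ⊗ (Hi ⊖ s n) ⊕ (ιℤ a ⊖ 1ᴷ ⊖ (1ᴷ ⊕ δ n))                   ≡⟨ cong (λ e → β′ ⊗ (Hi ⊖ s n) ⊕ (ιℤ a ⊖ 1ᴷ ⊖ e)) (sym (ιℤ-+ (+ 1) (d n))) ⟩
            β′ ⊗ (Hi ⊖ s n) ⊕ (ιℤ a ⊖ 1ᴷ ⊖ ιℤ (ℤ.suc (d n)))            ∎))
          (Pos-⊕-NonNeg (Pos-⊗ 0<β′ s<Hi) (<⇒NonNeg-ιℤ-1 (ℤP.≤∧≢⇒< (ℤP.i<j⇒suc[i]≤j (d<a n))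
            (λ d+1≡a → ℤP.<-irrefl (sym d′≡0) (d-after-largest n d+1≡a)))))

    digits-determined : ∀ {i j} → t i ≡ t j → d i ≡ d j
    digits-determined {i} {j} ti≡tj = IsFloor-unique (digit i) (subst (λ u → IsFloor (⊝ β ⊗ u ⊕ c) (d j)) (sym ti≡tj) (digit j))

    orbit-step-determined : ∀ i j → t i ≡ t j → t (suc i) ≡ t (suc j)
    orbit-step-determined i j ti≡tj = begin
      t (suc i)               ≡⟨ step i ⟩
      ⊝ β ⊗ t i ⊖ δ i         ≡⟨ cong₂ (λ u k → ⊝ β ⊗ u ⊖ ιℤ k) ti≡tj (digits-determined ti≡tj) ⟩
      ⊝ β ⊗ t j ⊖ δ j         ≡⟨ sym (step j) ⟩
      t (suc j)               ∎

    t≡-β′[t′+δ] : ∀ n → t n ≡ ⊝ β′ ⊗ (t (suc n) ⊕ δ n)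
    t≡-β′[t′+δ] n = sym (begin
      ⊝ β′ ⊗ (t (suc n) ⊕ δ n)           ≡⟨ cong (λ u → ⊝ β′ ⊗ (u ⊕ δ n)) (step n) ⟩
      ⊝ β′ ⊗ (⊝ β ⊗ t n ⊖ δ n ⊕ δ n)     ≡⟨ solve 4 (λ b b′ t δ → (:- b′) :* ((:- b) :* t :- δ :+ δ) := b :* b′ :* t) refl β β′ (t n) (δ n) ⟩
      β ⊗ β′ ⊗ t n                       ≡⟨ cong (_⊗ t n) ββ′≡1 ⟩
      1ᴷ ⊗ t n                           ≡⟨ ⊗-identityˡ (t n) ⟩
      t n                                ∎)

    -- Equal successors force digits differing by β′(s j − s i), of absolute value < β′β = 1.
    orbit-unstep : ∀ i j → t (suc i) ≡ t (suc j) → t i ≡ t j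
    orbit-unstep i j t′≡ = begin
      t i                           ≡⟨ t≡-β′[t′+δ] i ⟩
      ⊝ β′ ⊗ (t (suc i) ⊕ δ i)      ≡⟨ cong₂ (λ u k → ⊝ β′ ⊗ (u ⊕ ιℤ k)) t′≡ (ℤP.≤-antisym (digit-≤ i j t′≡) (digit-≤ j i (sym t′≡))) ⟩
      ⊝ β′ ⊗ (t (suc j) ⊕ δ j)      ≡⟨ sym (t≡-β′[t′+δ] j) ⟩
      t j                           ∎
      where
      digit-≤ : ∀ i j → t (suc i) ≡ t (suc j) → d i ℤ.≤ d j
      digit-≤ i j t′≡ = ιℤ-cancel-<-+1 (Pos-cancelˡ 0<β (subst Pos (sym (begin
        β ⊗ (δ j ⊕ 1ᴷ ⊖ δ i)                                      ≡⟨ cong (λ e → β ⊗ (δ j ⊕ 1ᴷ ⊖ e)) δi≡ ⟩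
        β ⊗ (δ j ⊕ 1ᴷ ⊖ (⊝ β′ ⊗ s i ⊖ (⊝ β′ ⊗ s j ⊖ δ j)))         ≡⟨ solve 5 (λ b b′ si sj δ → b :* (δ :+ con (+ 1) :- ((:- b′) :* si :- ((:- b′) :* sj :- δ)))
                                                                        := b :+ b :* b′ :* (si :- sj)) refl β β′ (s i) (s j) (δ j) ⟩
        β ⊕ β ⊗ β′ ⊗ (s i ⊖ s j)                                  ≡⟨ cong (λ e → β ⊕ e ⊗ (s i ⊖ s j)) ββ′≡1 ⟩
        β ⊕ 1ᴷ ⊗ (s i ⊖ s j)                                      ≡⟨ solve 4 (λ h b si sj → b :+ con (+ 1) :* (si :- sj) := (h :- sj) :+ (si :- (h :- b))) refl Hi β (s i) (s j) ⟩
        (Hi ⊖ s j) ⊕ (s i ⊖ Lo)                                   ∎))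
        (Pos-⊕ (proj₁ (proj₂ (conj-orbit-bounded j))) (proj₁ (conj-orbit-bounded i)))))
        where
        δi≡ : δ i ≡ ⊝ β′ ⊗ s i ⊖ (⊝ β′ ⊗ s j ⊖ δ j)
        δi≡ = begin
          δ i                                  ≡⟨ solve 3 (λ b′ s δ → δ := (:- b′) :* s :- ((:- b′) :* s :- δ)) refl β′ (s i) (δ i) ⟩
          ⊝ β′ ⊗ s i ⊖ (⊝ β′ ⊗ s i ⊖ δ i)      ≡⟨ cong (⊝ β′ ⊗ s i ⊖_) (trans (sym (s-step i)) (trans (cong conj t′≡) (s-step j))) ⟩
          ⊝ β′ ⊗ s i ⊖ (⊝ β′ ⊗ s j ⊖ δ j)      ∎

    Q : ℤ
    Q = ℚ.denominator x

    0<Q : Pos (ιℤ Q)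
    0<Q = Pos-ιℤ {Q} (ℤ.+<+ (ℕ.s≤s ℕ.z≤n))

    next-coordinates : ℤ → ℤ × ℤ → ℤ × ℤ
    next-coordinates k (u , v) = v ℤ.- Q ℤ.* k , ℤ.- (u ℤ.+ a ℤ.* v)

    coordinates : ℕ → ℤ × ℤ
    coordinates zero = ℚ.numerator x , + 0
    coordinates (suc n) = next-coordinates (d n) (coordinates n)

    U V : ℕ → ℤ
    U n = proj₁ (coordinates n)
    V n = proj₂ (coordinates n)

    Q-orbit : ∀ n → ιℤ Q ⊗ t n ≡ ιℤ (U n) ⊕ ιℤ (V n) ⊗ β
    Q-orbit zero = begin
      ιℤ Q ⊗ t 0                  ≡⟨ cong (ιℤ Q ⊗_) start ⟩
      ιℤ Q ⊗ ι x                  ≡⟨ sym (ι-* (ℤ→ℚ Q) x) ⟩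
      ι (ℤ→ℚ Q ℚ.* x)             ≡⟨ cong ι (ℤ→ℚ-Properties.denominator*x≡numerator x) ⟩
      ιℤ (U 0)                    ≡⟨ solve 2 (λ u b → u := u :+ con (+ 0) :* b) refl (ιℤ (U 0)) β ⟩
      ιℤ (U 0) ⊕ ιℤ (V 0) ⊗ β     ∎
    Q-orbit (suc n) = begin
      ιℤ Q ⊗ t (suc n)                                ≡⟨ cong (ιℤ Q ⊗_) (step n) ⟩
      ιℤ Q ⊗ (⊝ β ⊗ t n ⊖ δ n)                        ≡⟨ solve 4 (λ q b t δ → q :* ((:- b) :* t :- δ) := (:- b) :* (q :* t) :- q :* δ) refl (ιℤ Q) β (t n) (δ n) ⟩
      ⊝ β ⊗ (ιℤ Q ⊗ t n) ⊖ ιℤ Q ⊗ δ n                 ≡⟨ cong (λ e → ⊝ β ⊗ e ⊖ ιℤ Q ⊗ δ n) (Q-orbit n) ⟩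
      ⊝ β ⊗ (u ⊕ v ⊗ β) ⊖ ιℤ Q ⊗ δ n                  ≡⟨ solve 5 (λ b u v q δ → (:- b) :* (u :+ v :* b) :- q :* δ := (:- u) :* b :- v :* (b :* b) :- q :* δ) refl β u v (ιℤ Q) (δ n) ⟩
      ⊝ u ⊗ β ⊖ v ⊗ (β ⊗ β) ⊖ ιℤ Q ⊗ δ n              ≡⟨ cong (λ e → ⊝ u ⊗ β ⊖ v ⊗ e ⊖ ιℤ Q ⊗ δ n) β²≡aβ-1 ⟩
      ⊝ u ⊗ β ⊖ v ⊗ (ιℤ a ⊗ β ⊖ 1ᴷ) ⊖ ιℤ Q ⊗ δ n      ≡⟨ solve 6 (λ b u v q δ A → (:- u) :* b :- v :* (A :* b :- con (+ 1)) :- q :* δ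
                                                              := (v :- q :* δ) :+ (:- (u :+ A :* v)) :* b) refl β u v (ιℤ Q) (δ n) (ιℤ a) ⟩
      (v ⊖ ιℤ Q ⊗ δ n) ⊕ ⊝ (u ⊕ ιℤ a ⊗ v) ⊗ β         ≡⟨ sym (cong₂ (λ e f → e ⊕ f ⊗ β) ιℤ-U′ ιℤ-V′) ⟩
      ιℤ (U (suc n)) ⊕ ιℤ (V (suc n)) ⊗ β             ∎
      where
      u = ιℤ (U n)
      v = ιℤ (V n)
      ιℤ-U′ : ιℤ (U (suc n)) ≡ v ⊖ ιℤ Q ⊗ δ n
      ιℤ-U′ = trans (ιℤ-⊖ (V n) (Q ℤ.* d n)) (cong (v ⊖_) (ιℤ-* Q (d n)))
      ιℤ-V′ : ιℤ (V (suc n)) ≡ ⊝ (u ⊕ ιℤ a ⊗ v)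
      ιℤ-V′ = trans (ιℤ-⊝ (U n ℤ.+ a ℤ.* V n)) (cong ⊝_ (trans (ιℤ-+ (U n) (a ℤ.* V n)) (cong (u ⊕_) (ιℤ-* a (V n)))))

    Q-conj-orbit : ∀ n → ιℤ Q ⊗ s n ≡ ιℤ (U n) ⊕ ιℤ (V n) ⊗ β′
    Q-conj-orbit n = begin
      ιℤ Q ⊗ s n                          ≡⟨ sym (conj-⊗ (ιℤ Q) (t n)) ⟩
      conj (ιℤ Q ⊗ t n)                   ≡⟨ cong conj (Q-orbit n) ⟩
      conj (ιℤ (U n) ⊕ ιℤ (V n) ⊗ β)      ≡⟨ trans (conj-⊕ (ιℤ (U n)) (ιℤ (V n) ⊗ β)) (cong (ιℤ (U n) ⊕_) (conj-⊗ (ιℤ (V n)) β)) ⟩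
      ιℤ (U n) ⊕ ιℤ (V n) ⊗ β′            ∎

    t-within-1 : ∀ n → Within 1ᴷ (t n)
    t-within-1 n = within
      (subst Pos (solve 2 (λ c t → (con (+ 1) :- c :- t) :+ c := con (+ 1) :- t) refl c (t n)) (Pos-⊕ (proj₂ (orbit-in-I n)) 0<c))
      (subst Pos (solve 2 (λ c t → (t :+ c) :+ (con (+ 1) :- c) := con (+ 1) :+ t) refl c (t n)) (NonNeg-⊕-Pos (proj₁ (orbit-in-I n)) c<1))

    s-within-β : ∀ n → Within β (s n)
    s-within-β n = within
      (subst Pos (solve 4 (λ c b b′ s → (c :* (con (+ 1) :- b′) :- s) :+ (b :- con (+ 1)) :+ (con (+ 1) :- c) :+ c :* b′ := b :- s) refl c β β′ (s n))
        (Pos-⊕ (Pos-⊕ (Pos-⊕ (proj₁ (proj₂ (conj-orbit-bounded n))) 1<β) c<1) (Pos-⊗ 0<c 0<β′)))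
      (subst Pos (solve 3 (λ h b s → (s :- (h :- b)) :+ h := b :+ s) refl Hi β (s n))
        (Pos-⊕ (proj₁ (conj-orbit-bounded n)) (Pos-⊗ 0<c β′<1)))

    M : ℤ
    M = Q ℤ.* (+ 1 ℤ.+ a)

    ιℤM : ιℤ M ≡ ιℤ Q ⊗ (1ᴷ ⊕ (β ⊕ β′))
    ιℤM = trans (ιℤ-* Q (+ 1 ℤ.+ a)) (cong (ιℤ Q ⊗_) (trans (ιℤ-+ (+ 1) a) (cong (1ᴷ ⊕_) (sym β+β′≡a))))

    V-within-Q[1+β] : ∀ n → Within (ιℤ Q ⊗ (1ᴷ ⊕ β)) (ιℤ (V n))
    V-within-Q[1+β] n = Within-cancel (Pos⇒NonNeg 1<β-β′)
      (subst (Within (ιℤ Q ⊗ (1ᴷ ⊕ β))) Q[t-s]≡V[β-β′] (Within-⊗ 0<Q (Within-⊖ (t-within-1 n) (s-within-β n))))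
      where
      1<β-β′ : Pos (β ⊖ β′ ⊖ 1ᴷ)
      1<β-β′ = subst Pos (solve 2 (λ b b′ → (b :- con (+ 2)) :+ (con (+ 1) :- b′) := b :- b′ :- con (+ 1)) refl β β′) (Pos-⊕ 2<β β′<1)
      Q[t-s]≡V[β-β′] : ιℤ Q ⊗ (t n ⊖ s n) ≡ ιℤ (V n) ⊗ (β ⊖ β′)
      Q[t-s]≡V[β-β′] = begin
        ιℤ Q ⊗ (t n ⊖ s n)                                        ≡⟨ solve 3 (λ q t s → q :* (t :- s) := q :* t :- q :* s) refl (ιℤ Q) (t n) (s n) ⟩
        ιℤ Q ⊗ t n ⊖ ιℤ Q ⊗ s n                                   ≡⟨ cong₂ _⊖_ (Q-orbit n) (Q-conj-orbit n) ⟩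
        (ιℤ (U n) ⊕ ιℤ (V n) ⊗ β) ⊖ (ιℤ (U n) ⊕ ιℤ (V n) ⊗ β′)   ≡⟨ solve 4 (λ u v b b′ → (u :+ v :* b) :- (u :+ v :* b′) := v :* (b :- b′)) refl (ιℤ (U n)) (ιℤ (V n)) β β′ ⟩
        ιℤ (V n) ⊗ (β ⊖ β′)                                       ∎

    V-within : ∀ n → Within (ιℤ M) (ιℤ (V n))
    V-within n = Within-weaken (Pos⇒NonNeg (subst Pos Qβ′≡M-Q[1+β] (Pos-⊗ 0<Q 0<β′))) (V-within-Q[1+β] n)
      where
      Qβ′≡M-Q[1+β] : ιℤ Q ⊗ β′ ≡ ιℤ M ⊖ ιℤ Q ⊗ (1ᴷ ⊕ β)
      Qβ′≡M-Q[1+β] = sym (trans (cong (_⊖ ιℤ Q ⊗ (1ᴷ ⊕ β)) ιℤM)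
        (solve 3 (λ q b b′ → q :* (con (+ 1) :+ (b :+ b′)) :- q :* (con (+ 1) :+ b) := q :* b′) refl (ιℤ Q) β β′))

    -- The bound for U = Q s − V β′ comes out as Q (β + β′ + β β′) = Q (a + 1) exactly.
    U-within : ∀ n → Within (ιℤ M) (ιℤ (U n))
    U-within n = subst₂ Within (sym M≡Qβ+Q[1+β]β′) Qs-Vβ′≡U
      (Within-⊖ (Within-⊗ 0<Q (s-within-β n))
                (subst₂ Within (⊗-comm β′ (ιℤ Q ⊗ (1ᴷ ⊕ β))) (⊗-comm β′ (ιℤ (V n))) (Within-⊗ 0<β′ (V-within-Q[1+β] n))))
      where
      Qs-Vβ′≡U : ιℤ Q ⊗ s n ⊖ ιℤ (V n) ⊗ β′ ≡ ιℤ (U n)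
      Qs-Vβ′≡U = trans (cong (_⊖ ιℤ (V n) ⊗ β′) (Q-conj-orbit n))
        (solve 3 (λ u v b′ → u :+ v :* b′ :- v :* b′ := u) refl (ιℤ (U n)) (ιℤ (V n)) β′)
      M≡Qβ+Q[1+β]β′ : ιℤ M ≡ ιℤ Q ⊗ β ⊕ ιℤ Q ⊗ (1ᴷ ⊕ β) ⊗ β′
      M≡Qβ+Q[1+β]β′ = begin
        ιℤ M                                                 ≡⟨ ιℤM ⟩
        ιℤ Q ⊗ (1ᴷ ⊕ (β ⊕ β′))                               ≡⟨ cong (λ e → ιℤ Q ⊗ (e ⊕ (β ⊕ β′))) (sym ββ′≡1) ⟩
        ιℤ Q ⊗ (β ⊗ β′ ⊕ (β ⊕ β′))                           ≡⟨ solve 3 (λ q b b′ → q :* (b :* b′ :+ (b :+ b′)) := q :* b :+ q :* (con (+ 1) :+ b) :* b′) refl (ιℤ Q) β β′ ⟩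
        ιℤ Q ⊗ β ⊕ ιℤ Q ⊗ (1ᴷ ⊕ β) ⊗ β′                      ∎

    Mℕ : ℕ
    Mℕ = ℤ.∣ M ∣

    coordinates-bounded : ∀ h → (∀ n → Within (ιℤ M) (ιℤ (h n))) → Bounded Mℕ h
    coordinates-bounded h h-within n =
      subst (λ m → ℤ.- m ℤ.< h n × h n ℤ.< m) (sym +Mℕ≡M) (Within-ιℤ (h-within n))
      where
      +Mℕ≡M : + Mℕ ≡ M
      +Mℕ≡M = ℤP.0≤i⇒+∣i∣≡i (ℤP.<⇒≤ (Pos-ιℤ⁻¹ (Within⇒Pos (V-within 0))))

    orbit-repeats : ∃₂ λ i j → i ℕ.< j × t i ≡ t j
    orbit-repeats = repeats (bounded-pairs-repeat Mℕ U V (coordinates-bounded U U-within) (coordinates-bounded V V-within))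
      where
      repeats : (∃₂ λ i j → i ℕ.< j × U i ≡ U j × V i ≡ V j) → ∃₂ λ i j → i ℕ.< j × t i ≡ t j
      repeats (i , j , i<j , Ui≡Uj , Vi≡Vj) = i , j , i<j , ⊗-cancelˡ-Pos {ιℤ Q} {t i} {t j} 0<Q (begin
        ιℤ Q ⊗ t i                  ≡⟨ Q-orbit i ⟩
        ιℤ (U i) ⊕ ιℤ (V i) ⊗ β     ≡⟨ cong₂ (λ u v → ιℤ u ⊕ ιℤ v ⊗ β) Ui≡Uj Vi≡Vj ⟩
        ιℤ (U j) ⊕ ιℤ (V j) ⊗ β     ≡⟨ sym (Q-orbit j) ⟩
        ιℤ Q ⊗ t j                  ∎)

    periodic : PurelyPeriodic d
    periodic =
      let (_ , _ , i<j , ti≡tj) = orbit-repeats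
          (N , 0<N , t0≡tN) = return-from-repeat t orbit-unstep i<j ti≡tj
      in N , 0<N , λ k → digits-determined (periodic-from-return t orbit-step-determined N t0≡tN k)

theorem4 : (D : ℕ) → NonSquare D → (β : K) → QD.QuadPisotUnitPosConj D β →
           (c : K) → QD._⊗_ D c (QD._⊕_ D β (QD.ι D 1ℚ)) ≡ β →
           (x : ℚ) →
           QD._≤ᴷ_ D (QD.⊝_ D c) (QD.ι D x) × QD._<ᴷ_ D (QD.ι D x) (QD._⊖_ D (QD.ι D 1ℚ) c) →
           (t : ℕ → K) (d : ℕ → ℤ) → QD.IsNegBetaExpansion D β c (QD.ι D x) t d →
           PurelyPeriodic d
theorem4 D nonSquare β pisot c c[β+1]≡β x x∈I t d expansion =
  NegBetaOrbit.periodic D nonSquare β pisot c c[β+1]≡β x x∈I t d expansion
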